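{- Let $F(u)=C(x,y,z,u)$, $G(u)=C(x,z,y,u)$ and $q=yz$. Then \[ F(u)=A_y(u)+B_y(u)\, F(qu), \] where \[ A_y(u)=xyu+\frac{xyu}{1-yu} G(1)-\frac{x^2y^2 q u^3}{1-yu}-\frac{x^2y^2 q u^3}{(1-yu)(1-qu)} F(1),\qquad B_y(u)=\frac{x^2y^2 q^2 u^4}{(1-yu)(1-qu)}. \] Similarly, $G(u)=A_z(u)+B_z(u)\,G(qu)$, where $A_z(u),B_z(u)$ are obtained from $A_y(u),B_y(u)$ by interchanging $y$ and $z$ and interchanging $F(1)$ and $G(1)$.
   Context: A Catalan word of length $n\geq1$ is a sequence $w_1\cdots w_n$ of nonnegative integers with $w_1=0$ and $w_i\leq w_{i-1}+1$; its Catalan polyomino is the bargraph whose $i$th column has $w_i+1$ cells, columns bottom-aligned; $\mathbf{C}$ is the set of all Catalan polyominoes. For $P\in\mathbf{C}$: $\mathrm{lth}(P)$ = number of columns, $\mathrm{last}(P)$ = number of cells in the last column, $\mathrm{ver}(P)$ = total number of cells in columns of odd index (first column index 1), $\mathrm{white}(P)$ = total number of cells in columns of even index. $s(P)=\mathrm{ver}(P)$ if $\mathrm{lth}(P)$ odd, $s(P)=\mathrm{white}(P)$ if even; $\bar s(P)=\mathrm{ver}(P)$ if $\mathrm{lth}(P)$ even, $\bar s(P)=\mathrm{white}(P)$ if odd. $C(x,y,z,u)=\sum_{P\in\mathbf{C}}x^{\mathrm{lth}(P)}y^{s(P)}z^{\bar s(P)}u^{\mathrm{last}(P)}$. -}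

module Defs where

open import Data.Nat as ℕ using (ℕ; zero; suc; _≤?_; _∸_; _≟_)
open import Data.Integer as ℤ using (ℤ; +_)
open import Data.List using (List; []; _∷_; _++_; [_]; map; concatMap; upTo; length; sum; foldr; filter)
open import Data.Bool using (Bool; true; false; if_then_else_; _∧_; _∨_)
open import Relation.Nullary using (yes; no)
open import Relation.Binary.PropositionalEquality using (_≡_)
open import Relation.Nullary.Decidable using (⌊_⌋)

-- last letter of a nonempty word (0 for the empty word, never used)
lastLetter : List ℕ → ℕ
lastLetter []           = 0
lastLetter (w ∷ [])     = w
lastLetter (_ ∷ v ∷ vs) = lastLetter (v ∷ vs)

-- catWords n : all Catalan words of length n (n ≥ 1), i.e. all
-- w₁⋯wₙ with w₁ = 0 and wᵢ ≤ wᵢ₋₁ + 1.  Generated by appending every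
-- admissible last letter k ∈ {0,…,wₙ₋₁+1} to every word of length n-1.
catWords : ℕ → List (List ℕ)
catWords zero          = []
catWords (suc zero)    = [ 0 ∷ [] ]
catWords (suc (suc n)) =
  concatMap (λ w → map (λ k → w ++ [ k ]) (upTo (suc (suc (lastLetter w)))))
            (catWords (suc n))

-- Statistics of the Catalan polyomino of a word (column i has wᵢ+1 cells)

mutual
  -- total cells in columns of odd index (index starts at 1)
  oddCells : List ℕ → ℕ
  oddCells []      = 0
  oddCells (w ∷ t) = suc w ℕ.+ evenCells t
  evenCells : List ℕ → ℕ
  evenCells []      = 0
  evenCells (_ ∷ t) = oddCells t

ver white lth last : List ℕ → ℕ
ver   = oddCells
white = evenCells
lth   = length
last w = suc (lastLetter w)

isOdd : ℕ → Bool
isOdd zero          = false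
isOdd (suc zero)    = true
isOdd (suc (suc n)) = isOdd n

s sbar : List ℕ → ℕ
s    w = if isOdd (lth w) then ver w else white w
sbar w = if isOdd (lth w) then white w else ver w

-- Formal power series in x, y, z, u with integer coefficients:
-- f n a b c = coefficient of x^n y^a z^b u^c.

Series : Set
Series = ℕ → ℕ → ℕ → ℕ → ℤ

_==_ : ℕ → ℕ → Bool
m == n = ⌊ m ≟ n ⌋
infix 4 _==_

count : (List ℕ → Bool) → List (List ℕ) → ℕ
count p []       = 0
count p (w ∷ ws) = if p w then suc (count p ws) else count p ws

Cser : Series
Cser n a b c = + count (λ w → (s w == a) ∧ (sbar w == b) ∧ (last w == c)) (catWords n)

C1ser : Series
C1ser n a b zero    = + count (λ w → (s w == a) ∧ (sbar w == b)) (catWords n)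
C1ser n a b (suc _) = + 0

_⊕_ _⊖_ _⊛_ : Series → Series → Series
(f ⊕ g) n a b c = f n a b c ℤ.+ g n a b c
(f ⊖ g) n a b c = f n a b c ℤ.- g n a b c

Σ≤ : ℕ → (ℕ → ℤ) → ℤ
Σ≤ m h = foldr ℤ._+_ (+ 0) (map h (upTo (suc m)))

(f ⊛ g) n a b c =
  Σ≤ n λ i → Σ≤ a λ j → Σ≤ b λ k → Σ≤ c λ l →
    f i j k l ℤ.* g (n ∸ i) (a ∸ j) (b ∸ k) (c ∸ l)

infixl 6 _⊕_ _⊖_
infixl 7 _⊛_

mono : ℕ → ℕ → ℕ → ℕ → Series
mono p q r t n a b c =
  if (n == p) ∧ (a == q) ∧ (b == r) ∧ (c == t) then + 1 else + 0

-- geo p q r t = 1/(1 - x^p y^q z^r u^(suc t)) = Σ_{k≥0} (x^p y^q z^r u^(suc t))^k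
geo : ℕ → ℕ → ℕ → ℕ → Series
geo p q r t n a b c =
  if anyK (upTo (suc c)) then + 1 else + 0
  where
  anyK : List ℕ → Bool
  anyK []       = false
  anyK (k ∷ ks) = ((n == k ℕ.* p) ∧ (a == k ℕ.* q) ∧ (b == k ℕ.* r) ∧ (c == k ℕ.* suc t))
                  ∨ anyK ks

-- substitution u ↦ q u with q = y z :  f(x,y,z,yzu)
substQ : Series → Series
substQ f n a b c with c ≤? a | c ≤? b
... | yes _ | yes _ = f n (a ∸ c) (b ∸ c) c
... | _     | _     = + 0

swapYZ : Series → Series
swapYZ f n a b c = f n b a c

F G F1 G1 : Series
F  = Cser
G  = swapYZ Cser
F1 = C1ser
G1 = swapYZ C1ser

-- A_y(u) = xyu + xyu/(1-yu) G(1) - x²y²qu³/(1-yu) - x²y²qu³/((1-yu)(1-qu)) F(1)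
Ay : Series
Ay = mono 1 1 0 1
   ⊕ mono 1 1 0 1 ⊛ geo 0 1 0 0 ⊛ G1
   ⊖ mono 2 3 1 3 ⊛ geo 0 1 0 0
   ⊖ mono 2 3 1 3 ⊛ geo 0 1 0 0 ⊛ geo 0 1 1 0 ⊛ F1

-- B_y(u) = x²y²q²u⁴/((1-yu)(1-qu))
By : Series
By = mono 2 4 2 4 ⊛ geo 0 1 0 0 ⊛ geo 0 1 1 0

-- A_z, B_z: interchange y ↔ z and F(1) ↔ G(1)
Az : Series
Az = mono 1 0 1 1
   ⊕ mono 1 0 1 1 ⊛ geo 0 0 1 0 ⊛ F1
   ⊖ mono 2 1 3 3 ⊛ geo 0 0 1 0
   ⊖ mono 2 1 3 3 ⊛ geo 0 0 1 0 ⊛ geo 0 1 1 0 ⊛ G1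

Bz : Series
Bz = mono 2 2 4 4 ⊛ geo 0 0 1 0 ⊛ geo 0 1 1 0

_≐_ : Series → Series → Set
f ≐ g = ∀ n a b c → f n a b c ≡ g n a b c
infix 4 _≐_

{-# OPTIONS --safe #-}
module Submission where

-- Appending a letter k ≤ wₙ + 1 to a Catalan word w adds a column of height j = k + 1 and
-- exchanges the roles of s and s̄.  Hence, writing m(w) = x^lth(w) y^s̄(w) z^s(w) for the
-- monomial of w in G,
--   F(u) = x y u + Σ_w x m(w) ((yu) + (yu)² + ⋯ + (yu)^(last(w) + 1)),
-- and multiplying by 1 − yu telescopes each inner sum to yu − (yu)^(last(w) + 2):
--   (1 − yu) F(u) = x y u (1 − yu) + x y u G(1) − x y u · yu · G(yu).
-- By symmetry G satisfies the same recurrence with y and z exchanged, and substituting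
-- u ↦ yu in it gives (1 − qu) G(yu) in terms of F(1) and F(qu).  Dividing by 1 − yu and
-- 1 − qu and substituting the second equation into the first gives the lemma.  All of this
-- is checked coefficientwise in the ring of power series in x, y, z, u, obtained by
-- iterating the construction of univariate power series four times.

open import Defs
open import Algebra.Bundles using (CommutativeRing; CommutativeMonoid)
open import Algebra.Core using (Op₂)
open import Algebra.Structures using (IsCommutativeRing)
import Algebra.Construct.Pointwise as Pointwise
import Algebra.Solver.CommutativeMonoid as CommutativeMonoidSolver
open import Data.Bool using (Bool; true; false; if_then_else_; not; _∧_; _∨_)
open import Data.Bool.ListAction using (any)
open import Data.Bool.Properties
  using (not-involutive; ∧-zeroʳ; ∧-identityʳ; ∧-comm; ∨-zeroʳ; ∧-conicalʳ; T-≡; ∧-commutativeMonoid)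
open import Data.Integer as ℤ using (ℤ; 0ℤ; 1ℤ)
import Data.Integer.Properties as ℤ
open import Data.Integer.Tactic.RingSolver using (solve-∀)
open import Data.List using (List; []; _∷_; _++_; [_]; map; foldr; concatMap; length; upTo; applyUpTo)
open import Data.List.Membership.Propositional using (_∈_)
open import Data.List.Membership.Propositional.Properties using (∈-upTo⁺)
open import Data.List.Properties using (length-++)
open import Data.List.Relation.Unary.Any using (here; there)
open import Data.Nat using (ℕ; zero; suc; _∸_; _≤_; _≟_; _≡ᵇ_; _≤ᵇ_; _<ᵇ_; _≤?_)
open import Data.Product using (_×_; _,_)
open import Function using (_∘_; id; Equivalence)
open import Level using (0ℓ)
open import Relation.Nullary using (yes; no)
open import Relation.Nullary.Decidable using (isYes≗does; dec-true; dec-false)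
import Algebra.Solver.CommutativeMonoid ∧-commutativeMonoid as ∧-Solver
open import Algebra.Properties.CommutativeSemigroup (CommutativeMonoid.commutativeSemigroup ∧-commutativeMonoid)
  using () renaming (interchange to ∧-interchange; x∙yz≈y∙xz to ∧-x∙yz≈y∙xz)
open import Algebra.Properties.CommutativeSemigroup ℤ.+-commutativeSemigroup
  using () renaming (interchange to +-interchange)


-- Formal power series
module PowerSeries {c ℓ} (R : CommutativeRing c ℓ) where

  open CommutativeRing R hiding (isCommutativeRing)
  open import Algebra.Properties.CommutativeSemigroup +-commutativeSemigroup
    using (interchange; x∙yz≈y∙xz)
  open import Relation.Binary.Reasoning.Setoid setoid

  PowerSeries : Set c
  PowerSeries = ℕ → Carrier

  infix  4 _≋_
  infixl 6 _+ₚ_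
  infixl 7 _*ₚ_

  _≋_ : PowerSeries → PowerSeries → Set ℓ
  f ≋ g = ∀ n → f n ≈ g n

  _+ₚ_ : PowerSeries → PowerSeries → PowerSeries
  (f +ₚ g) n = f n + g n

  -ₚ_ : PowerSeries → PowerSeries
  (-ₚ f) n = - f n

  0ₚ : PowerSeries
  0ₚ _ = 0#

  1ₚ : PowerSeries
  1ₚ zero    = 1#
  1ₚ (suc _) = 0#

  Σ< : ℕ → (ℕ → Carrier) → Carrier
  Σ< zero    h = 0#
  Σ< (suc m) h = h 0 + Σ< m (h ∘ suc)

  _*ₚ_ : PowerSeries → PowerSeries → PowerSeries
  (f *ₚ g) n = Σ< (suc n) (λ i → f i * g (n ∸ i))

  Σ<-cong : ∀ m h h′ → (∀ i → h i ≈ h′ i) → Σ< m h ≈ Σ< m h′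
  Σ<-cong zero    h h′ h≈h′ = refl
  Σ<-cong (suc m) h h′ h≈h′ = +-cong (h≈h′ 0) (Σ<-cong m (h ∘ suc) (h′ ∘ suc) (h≈h′ ∘ suc))

  Σ<-0# : ∀ m → Σ< m (λ _ → 0#) ≈ 0#
  Σ<-0# zero    = refl
  Σ<-0# (suc m) = trans (+-congˡ (Σ<-0# m)) (+-identityʳ 0#)

  Σ<-+ : ∀ m h h′ → Σ< m (λ i → h i + h′ i) ≈ Σ< m h + Σ< m h′
  Σ<-+ zero    h h′ = sym (+-identityʳ 0#)
  Σ<-+ (suc m) h h′ = begin
    (h 0 + h′ 0) + Σ< m (λ i → h (suc i) + h′ (suc i)) ≈⟨ +-congˡ (Σ<-+ m (h ∘ suc) (h′ ∘ suc)) ⟩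
    (h 0 + h′ 0) + (Σ< m (h ∘ suc) + Σ< m (h′ ∘ suc)) ≈⟨ interchange _ _ _ _ ⟩
    (h 0 + Σ< m (h ∘ suc)) + (h′ 0 + Σ< m (h′ ∘ suc)) ∎

  Σ<-*ˡ : ∀ m k h → Σ< m (λ i → k * h i) ≈ k * Σ< m h
  Σ<-*ˡ zero    k h = sym (zeroʳ k)
  Σ<-*ˡ (suc m) k h = trans (+-congˡ (Σ<-*ˡ m k (h ∘ suc))) (sym (distribˡ k _ _))

  *ₚ-cong : ∀ {f f′ g g′} → f ≋ f′ → g ≋ g′ → f *ₚ g ≋ f′ *ₚ g′
  *ₚ-cong {f} {f′} {g} {g′} f≈f′ g≈g′ n = Σ<-cong (suc n) (λ i → f i * g (n ∸ i)) (λ i → f′ i * g′ (n ∸ i))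
                                                  (λ i → *-cong (f≈f′ i) (g≈g′ (n ∸ i)))

  *ₚ-distribʳ : ∀ h f g → (f +ₚ g) *ₚ h ≋ f *ₚ h +ₚ g *ₚ h
  *ₚ-distribʳ h f g n = trans (Σ<-cong (suc n) _ (λ i → fh i + gh i) (λ i → distribʳ (h (n ∸ i)) (f i) (g i)))
                               (Σ<-+ (suc n) fh gh)
    where
    fh gh : ℕ → Carrier
    fh i = f i * h (n ∸ i)
    gh i = g i * h (n ∸ i)

  *ₚ-identityˡ : ∀ f → 1ₚ *ₚ f ≋ f
  *ₚ-identityˡ f zero    = trans (+-identityʳ _) (*-identityˡ (f 0))
  *ₚ-identityˡ f (suc n) = begin
    1# * f (suc n) + Σ< (suc n) (λ i → 0# * f (n ∸ i))
      ≈⟨ +-cong (*-identityˡ _) (Σ<-cong (suc n) (λ i → 0# * f (n ∸ i)) _ (λ i → zeroˡ _)) ⟩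
    f (suc n) + Σ< (suc n) (λ _ → 0#)                  ≈⟨ +-congˡ (Σ<-0# (suc n)) ⟩
    f (suc n) + 0#                                     ≈⟨ +-identityʳ _ ⟩
    f (suc n)                                          ∎

  -- Associativity and commutativity recurse on (f *ₚ g) (suc n) = f 0 * g (suc n) + ((f ∘ suc) *ₚ g) n,
  -- which holds by computation.
  *ₚ-assoc : ∀ f g h → (f *ₚ g) *ₚ h ≋ f *ₚ (g *ₚ h)
  *ₚ-assoc f g h zero = begin
    (f 0 * g 0 + 0#) * h 0 + 0# ≈⟨ +-congʳ (*-congʳ (+-identityʳ _)) ⟩
    f 0 * g 0 * h 0 + 0#        ≈⟨ +-congʳ (*-assoc _ _ _) ⟩
    f 0 * (g 0 * h 0) + 0#      ≈⟨ +-congʳ (*-congˡ (sym (+-identityʳ _))) ⟩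
    f 0 * (g 0 * h 0 + 0#) + 0# ∎
  *ₚ-assoc f g h (suc n) = begin
    (f *ₚ g) 0 * h (suc n) + ((f 0 ·ₚ (g ∘ suc) +ₚ (f ∘ suc) *ₚ g) *ₚ h) n
      ≈⟨ +-cong (*-congʳ (+-identityʳ _)) (*ₚ-distribʳ h (f 0 ·ₚ (g ∘ suc)) ((f ∘ suc) *ₚ g) n) ⟩
    f 0 * g 0 * h (suc n) + (((f 0 ·ₚ (g ∘ suc)) *ₚ h) n + (((f ∘ suc) *ₚ g) *ₚ h) n)
      ≈⟨ +-cong (*-assoc _ _ _) (+-cong (scale n) (*ₚ-assoc (f ∘ suc) g h n)) ⟩
    f 0 * (g 0 * h (suc n)) + (f 0 * ((g ∘ suc) *ₚ h) n + ((f ∘ suc) *ₚ (g *ₚ h)) n)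
      ≈⟨ sym (+-assoc _ _ _) ⟩
    (f 0 * (g 0 * h (suc n)) + f 0 * ((g ∘ suc) *ₚ h) n) + ((f ∘ suc) *ₚ (g *ₚ h)) n
      ≈⟨ +-congʳ (sym (distribˡ (f 0) _ _)) ⟩
    f 0 * (g *ₚ h) (suc n) + ((f ∘ suc) *ₚ (g *ₚ h)) n ∎
    where
    _·ₚ_ : Carrier → PowerSeries → PowerSeries
    (k ·ₚ f′) i = k * f′ i
    scale : ∀ n → ((f 0 ·ₚ (g ∘ suc)) *ₚ h) n ≈ f 0 * ((g ∘ suc) *ₚ h) n
    scale n = trans (Σ<-cong (suc n) (λ i → f 0 * g (suc i) * h (n ∸ i)) _ (λ i → *-assoc _ _ _))
                    (Σ<-*ˡ (suc n) (f 0) (λ i → g (suc i) * h (n ∸ i)))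

  *ₚ-comm : ∀ f g → f *ₚ g ≋ g *ₚ f
  *ₚ-comm f g zero                = +-congʳ (*-comm (f 0) (g 0))
  *ₚ-comm f g (suc zero)          = begin
    f 0 * g 1 + (f 1 * g 0 + 0#) ≈⟨ +-cong (*-comm _ _) (+-congʳ (*-comm _ _)) ⟩
    g 1 * f 0 + (g 0 * f 1 + 0#) ≈⟨ x∙yz≈y∙xz _ _ _ ⟩
    g 0 * f 1 + (g 1 * f 0 + 0#) ∎
  *ₚ-comm f g (suc (suc n)) = begin
    f 0 * g (2+ n) + ((f ∘ suc) *ₚ g) (suc n)
      ≈⟨ +-congˡ (*ₚ-comm (f ∘ suc) g (suc n)) ⟩
    f 0 * g (2+ n) + (g 0 * f (2+ n) + ((g ∘ suc) *ₚ (f ∘ suc)) n)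
      ≈⟨ +-congˡ (+-congˡ (*ₚ-comm (g ∘ suc) (f ∘ suc) n)) ⟩
    f 0 * g (2+ n) + (g 0 * f (2+ n) + ((f ∘ suc) *ₚ (g ∘ suc)) n)
      ≈⟨ x∙yz≈y∙xz _ _ _ ⟩
    g 0 * f (2+ n) + (f 0 * g (2+ n) + ((f ∘ suc) *ₚ (g ∘ suc)) n)
      ≈⟨ +-congˡ (*ₚ-comm f (g ∘ suc) (suc n)) ⟩
    g 0 * f (2+ n) + ((g ∘ suc) *ₚ f) (suc n) ∎
    where
    2+ : ℕ → ℕ
    2+ n = suc (suc n)

  isCommutativeRing : IsCommutativeRing _≋_ _+ₚ_ _*ₚ_ -ₚ_ 0ₚ 1ₚ
  isCommutativeRing = record
    { isRing = record
      { +-isAbelianGroup = Pointwise.isAbelianGroup ℕ +-isAbelianGroup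
      ; *-cong           = *ₚ-cong
      ; *-assoc          = *ₚ-assoc
      ; *-identity       = *ₚ-identityˡ , λ f n → trans (*ₚ-comm f 1ₚ n) (*ₚ-identityˡ f n)
      ; distrib          = (λ h f g n → trans (*ₚ-comm h (f +ₚ g) n)
                                       (trans (*ₚ-distribʳ h f g n) (+-cong (*ₚ-comm f h n) (*ₚ-comm g h n))))
                         , *ₚ-distribʳ
      }
    ; *-comm = *ₚ-comm
    }

  commutativeRing : CommutativeRing c ℓ
  commutativeRing = record { isCommutativeRing = isCommutativeRing }

module _ {c ℓ} (R : CommutativeRing c ℓ) where

  open CommutativeRing R hiding (isCommutativeRing)
  open import Relation.Binary.Reasoning.Setoid setoid

  isCommutativeRing-with-* : (_*′_ : Op₂ Carrier) → (∀ x y → x *′ y ≈ x * y) →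
                             IsCommutativeRing _≈_ _+_ _*′_ -_ 0# 1#
  isCommutativeRing-with-* _*′_ *′≈* = record
    { isRing = record
      { +-isAbelianGroup = +-isAbelianGroup
      ; *-cong     = λ {x} {x′} {y} {y′} x≈x′ y≈y′ → begin
          x *′ y   ≈⟨ *′≈* x y ⟩
          x * y    ≈⟨ *-cong x≈x′ y≈y′ ⟩
          x′ * y′  ≈⟨ *′≈* x′ y′ ⟨
          x′ *′ y′ ∎
      ; *-assoc    = λ x y z → begin
          (x *′ y) *′ z ≈⟨ *′≈* (x *′ y) z ⟩
          (x *′ y) * z  ≈⟨ *-congʳ (*′≈* x y) ⟩
          (x * y) * z   ≈⟨ *-assoc x y z ⟩
          x * (y * z)   ≈⟨ *-congˡ (*′≈* y z) ⟨
          x * (y *′ z)  ≈⟨ *′≈* x (y *′ z) ⟨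
          x *′ (y *′ z) ∎
      ; *-identity = (λ x → trans (*′≈* 1# x) (*-identityˡ x)) , (λ x → trans (*′≈* x 1#) (*-identityʳ x))
      ; distrib    = (λ x y z → begin
          x *′ (y + z)      ≈⟨ *′≈* x (y + z) ⟩
          x * (y + z)       ≈⟨ distribˡ x y z ⟩
          x * y + x * z     ≈⟨ +-cong (*′≈* x y) (*′≈* x z) ⟨
          x *′ y + x *′ z   ∎)
                   , (λ x y z → begin
          (y + z) *′ x      ≈⟨ *′≈* (y + z) x ⟩
          (y + z) * x       ≈⟨ distribʳ x y z ⟩
          y * x + z * x     ≈⟨ +-cong (*′≈* y x) (*′≈* z x) ⟨
          y *′ x + z *′ x   ∎)
      }
    ; *-comm = λ x y → trans (*′≈* x y) (trans (*-comm x y) (sym (*′≈* y x)))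
    }


-- Linear recurrences in a commutative ring
module LinearRecurrences {ℓ₁ ℓ₂} (R : CommutativeRing ℓ₁ ℓ₂) where

  open CommutativeRing R
  open import Relation.Binary.Reasoning.Setoid setoid
  open import Algebra.Properties.Ring ring using (x[y-z]≈xy-xz; [y-z]x≈yx-zx)
  open import Algebra.Properties.AbelianGroup +-abelianGroup using (⁻¹-∙-comm; ⁻¹-involutive)
  open import Algebra.Properties.Group +-group using (//-rightDividesʳ)
  module +-Solver = CommutativeMonoidSolver +-commutativeMonoid
  module *-Solver = CommutativeMonoidSolver *-commutativeMonoid

  x+y-x≈y : ∀ x y → (x + y) - x ≈ y
  x+y-x≈y x y = trans (+-congʳ (+-comm x y)) (//-rightDividesʳ x y)

  geometric-inverse : ∀ {g y} → g ≈ 1# + y * g → g - y * g ≈ 1#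
  geometric-inverse {g} {y} g-rec = trans (+-congʳ g-rec) (//-rightDividesʳ (y * g) 1#)

  linear-recurrence : ∀ {f g y r} → g ≈ 1# + y * g → f ≈ y * f + r → f ≈ g * r
  linear-recurrence {f} {g} {y} {r} g-rec f-rec = sym (begin
    g * r                ≈⟨ *-congˡ (trans (+-congʳ f-rec) (x+y-x≈y (y * f) r)) ⟨
    g * (f - y * f)      ≈⟨ x[y-z]≈xy-xz g f (y * f) ⟩
    g * f - g * (y * f)  ≈⟨ +-congˡ (-‿cong (trans (sym (*-assoc g y f)) (*-congʳ (*-comm g y)))) ⟩
    g * f - y * g * f    ≈⟨ [y-z]x≈yx-zx f g (y * g) ⟨
    (g - y * g) * f      ≈⟨ *-congʳ (geometric-inverse g-rec) ⟩
    1# * f               ≈⟨ *-identityˡ f ⟩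
    f                    ∎)

  recurrence-solution : ∀ {f g y x t} → g ≈ 1# + y * g → f ≈ y * f + (x - x * y + t) → f ≈ x + g * t
  recurrence-solution {f} {g} {y} {x} {t} g-rec f-rec = begin
    f                        ≈⟨ linear-recurrence g-rec f-rec ⟩
    g * (x - x * y + t)      ≈⟨ distribˡ g (x - x * y) t ⟩
    g * (x - x * y) + g * t  ≈⟨ +-congʳ g[x-xy]≈x ⟩
    x + g * t                ∎
    where
    g[x-xy]≈x : g * (x - x * y) ≈ x
    g[x-xy]≈x = begin
      g * (x - x * y)        ≈⟨ *-comm g _ ⟩
      (x - x * y) * g        ≈⟨ [y-z]x≈yx-zx g x (x * y) ⟩
      x * g - x * y * g      ≈⟨ +-congˡ (-‿cong (*-assoc x y g)) ⟩
      x * g - x * (y * g)    ≈⟨ x[y-z]≈xy-xz x g (y * g) ⟨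
      x * (g - y * g)        ≈⟨ *-congˡ (geometric-inverse g-rec) ⟩
      x * 1#                 ≈⟨ *-identityʳ x ⟩
      x                      ∎

  nested-recurrence-solution : ∀ {f s s′ h h′ x y w q g g′ m₃ m₄} →
    f ≈ x + g * (x * h - x * y * s) → s ≈ w + g′ * (w * h′ - w * q * s′) →
    m₃ ≈ x * y * w → m₄ ≈ m₃ * q →
    f ≈ x + x * g * h - m₃ * g - m₃ * g * g′ * h′ + m₄ * g * g′ * s′
  nested-recurrence-solution {f} {s} {s′} {h} {h′} {x} {y} {w} {q} {g} {g′} {m₃} {m₄} f≈ s≈ m₃≈ m₄≈ = begin
    f                                    ≈⟨ f≈ ⟩
    x + g * (x * h - x * y * s)          ≈⟨ +-congˡ (x[y-z]≈xy-xz g (x * h) (x * y * s)) ⟩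
    x + (g * (x * h) - g * (x * y * s))  ≈⟨ +-congˡ (+-cong gxh (-‿cong gxys)) ⟩
    x + (x * g * h - (a + (b - c)))      ≈⟨ +-congˡ (+-congˡ negate) ⟩
    x + (x * g * h + (- a + (- b + c)))  ≈⟨ +-Solver.solve 5 (λ x d a b c →
                                                x ⊞ (d ⊞ (a ⊞ (b ⊞ c))) ⊜ (((x ⊞ d) ⊞ a) ⊞ b) ⊞ c) refl x (x * g * h) (- a) (- b) c ⟩
    x + x * g * h - a - b + c            ∎
    where
    open +-Solver using (_⊜_) renaming (_⊕_ to infixr 5 _⊞_)
    open *-Solver using () renaming (_⊕_ to infixr 5 _⊙_; _⊜_ to infix 4 _⊜*_)
    a b c P : Carrier
    a = m₃ * g
    b = m₃ * g * g′ * h′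
    c = m₄ * g * g′ * s′
    P = g * (x * y)
    gxh : g * (x * h) ≈ x * g * h
    gxh = *-Solver.solve 3 (λ g x h → g ⊙ (x ⊙ h) ⊜* (x ⊙ g) ⊙ h) refl g x h
    Pw : P * w ≈ a
    Pw = trans (*-Solver.solve 4 (λ g x y w → (g ⊙ (x ⊙ y)) ⊙ w ⊜* ((x ⊙ y) ⊙ w) ⊙ g) refl g x y w)
               (*-congʳ (sym m₃≈))
    Pg′wh′ : P * (g′ * (w * h′)) ≈ b
    Pg′wh′ = trans (*-Solver.solve 6 (λ g x y g′ w h′ →
                      (g ⊙ (x ⊙ y)) ⊙ (g′ ⊙ (w ⊙ h′)) ⊜* ((((x ⊙ y) ⊙ w) ⊙ g) ⊙ g′) ⊙ h′)
                      refl g x y g′ w h′)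
                   (*-congʳ (*-congʳ (*-congʳ (sym m₃≈))))
    Pg′wqs′ : P * (g′ * (w * q * s′)) ≈ c
    Pg′wqs′ = trans (*-Solver.solve 7 (λ g x y g′ w q s′ →
                       (g ⊙ (x ⊙ y)) ⊙ (g′ ⊙ ((w ⊙ q) ⊙ s′)) ⊜* (((((x ⊙ y) ⊙ w) ⊙ q) ⊙ g) ⊙ g′) ⊙ s′)
                       refl g x y g′ w q s′)
                    (*-congʳ (*-congʳ (*-congʳ (sym (trans m₄≈ (*-congʳ m₃≈))))))
    gxys : g * (x * y * s) ≈ a + (b - c)
    gxys = begin
      g * (x * y * s)                                          ≈⟨ *-assoc g (x * y) s ⟨
      P * s                                                    ≈⟨ *-congˡ s≈ ⟩
      P * (w + g′ * (w * h′ - w * q * s′))                     ≈⟨ distribˡ P w _ ⟩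
      P * w + P * (g′ * (w * h′ - w * q * s′))
        ≈⟨ +-congˡ (*-congˡ (x[y-z]≈xy-xz g′ _ _)) ⟩
      P * w + P * (g′ * (w * h′) - g′ * (w * q * s′))
        ≈⟨ +-congˡ (x[y-z]≈xy-xz P _ _) ⟩
      P * w + (P * (g′ * (w * h′)) - P * (g′ * (w * q * s′)))
        ≈⟨ +-cong Pw (+-cong Pg′wh′ (-‿cong Pg′wqs′)) ⟩
      a + (b - c)                                              ∎
    negate : - (a + (b - c)) ≈ - a + (- b + c)
    negate = trans (sym (⁻¹-∙-comm a (b - c)))
                   (+-congˡ (trans (sym (⁻¹-∙-comm b (- c))) (+-congˡ (⁻¹-involutive c))))

open import Data.Nat.Properties
  using (n<1+n; *-identityʳ; ≡ᵇ⇒≡; ≤ᵇ⇒≤; ∸-+-assoc; +-identityʳ; +-assoc; +-comm; +-suc; m+[n∸m]≡n)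
open import Data.Nat using (_+_; _*_)
open import Relation.Binary.PropositionalEquality as ≡ using (_≡_; refl; cong; cong₂; sym; trans)


powerSeriesRing : ℕ → CommutativeRing 0ℓ 0ℓ
powerSeriesRing zero    = ℤ.+-*-commutativeRing
powerSeriesRing (suc k) = PowerSeries.commutativeRing (powerSeriesRing k)

Σ<-apply : ∀ {c ℓ} (R : CommutativeRing c ℓ) m (h : ℕ → ℕ → CommutativeRing.Carrier R) i →
  PowerSeries.Σ< (PowerSeries.commutativeRing R) m h i ≡ PowerSeries.Σ< R m (λ j → h j i)
Σ<-apply R zero    h i = refl
Σ<-apply R (suc m) h i = cong (CommutativeRing._+_ R (h 0 i)) (Σ<-apply R m (h ∘ suc) i)

module ℤ[[1]] = PowerSeries (powerSeriesRing 0)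
module ℤ[[2]] = PowerSeries (powerSeriesRing 1)
module ℤ[[3]] = PowerSeries (powerSeriesRing 2)
module ℤ[[4]] = PowerSeries (powerSeriesRing 3)

foldr-map-applyUpTo : ∀ (h : ℕ → ℤ) f k →
  foldr ℤ._+_ 0ℤ (map h (applyUpTo f k)) ≡ ℤ[[1]].Σ< k (h ∘ f)
foldr-map-applyUpTo h f zero    = refl
foldr-map-applyUpTo h f (suc k) = cong (ℤ._+_ (h (f 0))) (foldr-map-applyUpTo h (f ∘ suc) k)

Σ≤≡Σ< : ∀ m h → Σ≤ m h ≡ ℤ[[1]].Σ< (suc m) h
Σ≤≡Σ< m h = foldr-map-applyUpTo h id (suc m)

Σ≤-conv₁ : ∀ (f g : ℕ → ℤ) c → Σ≤ c (λ l → f l ℤ.* g (c ∸ l)) ≡ (f ℤ[[1]].*ₚ g) c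
Σ≤-conv₁ f g c = Σ≤≡Σ< c (λ l → f l ℤ.* g (c ∸ l))

Σ≤-conv₂ : ∀ (f g : ℕ → ℕ → ℤ) b c →
  Σ≤ b (λ k → Σ≤ c (λ l → f k l ℤ.* g (b ∸ k) (c ∸ l))) ≡ (f ℤ[[2]].*ₚ g) b c
Σ≤-conv₂ f g b c = begin
  Σ≤ b summand                                           ≡⟨ Σ≤≡Σ< b summand ⟩
  ℤ[[1]].Σ< (suc b) summand
    ≡⟨ ℤ[[1]].Σ<-cong (suc b) summand _ (λ k → Σ≤-conv₁ (f k) (g (b ∸ k)) c) ⟩
  ℤ[[1]].Σ< (suc b) (λ k → (f k ℤ[[1]].*ₚ g (b ∸ k)) c)
    ≡⟨ Σ<-apply (powerSeriesRing 0) (suc b) (λ k → f k ℤ[[1]].*ₚ g (b ∸ k)) c ⟨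
  (f ℤ[[2]].*ₚ g) b c                                    ∎
  where
  open ≡.≡-Reasoning
  summand : ℕ → ℤ
  summand k = Σ≤ c (λ l → f k l ℤ.* g (b ∸ k) (c ∸ l))

Σ≤-conv₃ : ∀ (f g : ℕ → ℕ → ℕ → ℤ) a b c →
  Σ≤ a (λ j → Σ≤ b (λ k → Σ≤ c (λ l → f j k l ℤ.* g (a ∸ j) (b ∸ k) (c ∸ l))))
    ≡ (f ℤ[[3]].*ₚ g) a b c
Σ≤-conv₃ f g a b c = begin
  Σ≤ a summand                                             ≡⟨ Σ≤≡Σ< a summand ⟩
  ℤ[[1]].Σ< (suc a) summand
    ≡⟨ ℤ[[1]].Σ<-cong (suc a) summand _ (λ j → Σ≤-conv₂ (f j) (g (a ∸ j)) b c) ⟩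
  ℤ[[1]].Σ< (suc a) (λ j → (f j ℤ[[2]].*ₚ g (a ∸ j)) b c)
    ≡⟨ Σ<-apply (powerSeriesRing 0) (suc a) (λ j → (f j ℤ[[2]].*ₚ g (a ∸ j)) b) c ⟨
  ℤ[[2]].Σ< (suc a) (λ j → (f j ℤ[[2]].*ₚ g (a ∸ j)) b) c
    ≡⟨ cong (λ φ → φ c) (Σ<-apply (powerSeriesRing 1) (suc a) (λ j → f j ℤ[[2]].*ₚ g (a ∸ j)) b) ⟨
  (f ℤ[[3]].*ₚ g) a b c                                    ∎
  where
  open ≡.≡-Reasoning
  summand : ℕ → ℤ
  summand j = Σ≤ b (λ k → Σ≤ c (λ l → f j k l ℤ.* g (a ∸ j) (b ∸ k) (c ∸ l)))

⊛≐*ₚ : ∀ f g → f ⊛ g ≐ f ℤ[[4]].*ₚ g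
⊛≐*ₚ f g n a b c = begin
  Σ≤ n summand                                               ≡⟨ Σ≤≡Σ< n summand ⟩
  ℤ[[1]].Σ< (suc n) summand
    ≡⟨ ℤ[[1]].Σ<-cong (suc n) summand _ (λ i → Σ≤-conv₃ (f i) (g (n ∸ i)) a b c) ⟩
  ℤ[[1]].Σ< (suc n) (λ i → (f i ℤ[[3]].*ₚ g (n ∸ i)) a b c)
    ≡⟨ Σ<-apply (powerSeriesRing 0) (suc n) (λ i → (f i ℤ[[3]].*ₚ g (n ∸ i)) a b) c ⟨
  ℤ[[2]].Σ< (suc n) (λ i → (f i ℤ[[3]].*ₚ g (n ∸ i)) a b) c
    ≡⟨ cong (λ φ → φ c) (Σ<-apply (powerSeriesRing 1) (suc n) (λ i → (f i ℤ[[3]].*ₚ g (n ∸ i)) a) b) ⟨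
  ℤ[[3]].Σ< (suc n) (λ i → (f i ℤ[[3]].*ₚ g (n ∸ i)) a) b c
    ≡⟨ cong (λ φ → φ b c) (Σ<-apply (powerSeriesRing 2) (suc n) (λ i → f i ℤ[[3]].*ₚ g (n ∸ i)) a) ⟨
  (f ℤ[[4]].*ₚ g) n a b c                                    ∎
  where
  open ≡.≡-Reasoning
  summand : ℕ → ℤ
  summand i = Σ≤ a (λ j → Σ≤ b (λ k → Σ≤ c (λ l → f i j k l ℤ.* g (n ∸ i) (a ∸ j) (b ∸ k) (c ∸ l))))

seriesRing : CommutativeRing 0ℓ 0ℓ
seriesRing = record
  { Carrier           = Series
  ; _≈_               = _≐_
  ; _+_               = _⊕_
  ; _*_               = _⊛_
  ; -_                = λ f n a b c → ℤ.- f n a b c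
  ; 0#                = λ _ _ _ _ → 0ℤ
  ; 1#                = ℤ[[4]].1ₚ
  ; isCommutativeRing = isCommutativeRing-with-* (powerSeriesRing 4) _⊛_ ⊛≐*ₚ
  }

module Ser = CommutativeRing seriesRing


when : Bool → ℤ → ℤ
when β z = if β then z else 0ℤ

when-zero : ∀ β → when β 0ℤ ≡ 0ℤ
when-zero false = refl
when-zero true  = refl

when-∧ : ∀ β γ z → when (β ∧ γ) z ≡ when β (when γ z)
when-∧ false γ z = refl
when-∧ true  γ z = refl

when⁴ : ∀ β₁ β₂ β₃ β₄ z →
  when (β₁ ∧ β₂ ∧ β₃ ∧ β₄) z ≡ when β₁ (when β₂ (when β₃ (when β₄ z)))
when⁴ β₁ β₂ β₃ β₄ z = trans (when-∧ β₁ _ z)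
  (cong (when β₁) (trans (when-∧ β₂ _ z) (cong (when β₂) (when-∧ β₃ β₄ z))))

when-cong-true : ∀ β {x y} → (β ≡ true → x ≡ y) → when β x ≡ when β y
when-cong-true false x≡y = refl
when-cong-true true  x≡y = cong (when true) (x≡y refl)

==⇒≡ᵇ : ∀ m n → (m == n) ≡ (m ≡ᵇ n)
==⇒≡ᵇ m n = isYes≗does (m ≟ n)

≡ᵇ-sym : ∀ m n → (m ≡ᵇ n) ≡ (n ≡ᵇ m)
≡ᵇ-sym zero    zero    = refl
≡ᵇ-sym zero    (suc n) = refl
≡ᵇ-sym (suc m) zero    = refl
≡ᵇ-sym (suc m) (suc n) = ≡ᵇ-sym m n

<ᵇ-suc : ∀ p m → (p <ᵇ suc m) ≡ (p ≤ᵇ m)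
<ᵇ-suc zero    m = refl
<ᵇ-suc (suc p) m = refl

==-sound : ∀ m n → (m == n) ≡ true → m ≡ n
==-sound m n m==n = ≡ᵇ⇒≡ m n (Equivalence.from T-≡ (trans (sym (==⇒≡ᵇ m n)) m==n))

≤ᵇ-sound : ∀ m n → (m ≤ᵇ n) ≡ true → m ≤ n
≤ᵇ-sound m n m≤ᵇn = ≤ᵇ⇒≤ m n (Equivalence.from T-≡ m≤ᵇn)

≤ᵇ∧∸≡ᵇ : ∀ p n m → (p ≤ᵇ n) ∧ (n ∸ p ≡ᵇ m) ≡ (n ≡ᵇ p + m)
≤ᵇ∧∸≡ᵇ zero    n       m = refl
≤ᵇ∧∸≡ᵇ (suc p) zero    m = refl
≤ᵇ∧∸≡ᵇ (suc p) (suc n) m = trans (cong (_∧ (n ∸ p ≡ᵇ m)) (<ᵇ-suc p n)) (≤ᵇ∧∸≡ᵇ p n m)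

≤ᵇ∧≤ᵇ∸ : ∀ x y a → (x ≤ᵇ a) ∧ (y ≤ᵇ a ∸ x) ≡ (x + y ≤ᵇ a)
≤ᵇ∧≤ᵇ∸ zero    y a       = refl
≤ᵇ∧≤ᵇ∸ (suc x) y zero    = refl
≤ᵇ∧≤ᵇ∸ (suc x) y (suc a) =
  trans (cong (_∧ (y ≤ᵇ a ∸ x)) (<ᵇ-suc x a)) (trans (≤ᵇ∧≤ᵇ∸ x y a) (sym (<ᵇ-suc (x + y) a)))

when-≤ᵇ-∸ : ∀ x y a (g : ℕ → ℤ) →
  when (x ≤ᵇ a) (when (y ≤ᵇ a ∸ x) (g (a ∸ x ∸ y))) ≡ when (x + y ≤ᵇ a) (g (a ∸ (x + y)))
when-≤ᵇ-∸ x y a g = trans (sym (when-∧ (x ≤ᵇ a) _ _))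
  (cong₂ when (≤ᵇ∧≤ᵇ∸ x y a) (cong g (∸-+-assoc a x y)))

∧-zip⁴ : ∀ a b c d a′ b′ c′ d′ →
  (a ∧ b ∧ c ∧ d) ∧ (a′ ∧ b′ ∧ c′ ∧ d′) ≡ (a ∧ a′) ∧ (b ∧ b′) ∧ (c ∧ c′) ∧ (d ∧ d′)
∧-zip⁴ a b c d a′ b′ c′ d′ = trans (∧-interchange a _ a′ _)
  (cong ((a ∧ a′) ∧_) (trans (∧-interchange b _ b′ _) (cong ((b ∧ b′) ∧_) (∧-interchange c d c′ d′))))

∧-swap-middle : ∀ x y z w → x ∧ y ∧ z ∧ w ≡ x ∧ z ∧ y ∧ w
∧-swap-middle x y z w = cong (x ∧_) (∧-x∙yz≈y∙xz y z w)

∧-shuffle : ∀ x p q r t → x ∧ (p ∧ q ∧ r ∧ t) ≡ t ∧ p ∧ r ∧ x ∧ q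
∧-shuffle = ∧-Solver.solve 5 (λ x p q r t → x & (p & q & r & t) ⊜ t & p & r & x & q) refl
  where open ∧-Solver using (_⊜_) renaming (_⊕_ to _&_)


-- Multiplication by a monomial
mono-≡ᵇ : ∀ p q r t n a b c →
  mono p q r t n a b c ≡ when ((n ≡ᵇ p) ∧ (a ≡ᵇ q) ∧ (b ≡ᵇ r) ∧ (c ≡ᵇ t)) 1ℤ
mono-≡ᵇ p q r t n a b c rewrite ==⇒≡ᵇ n p | ==⇒≡ᵇ a q | ==⇒≡ᵇ b r | ==⇒≡ᵇ c t = refl

shift : ℕ → ℕ → ℕ → ℕ → Series → Series
shift p q r t f n a b c =
  when ((p ≤ᵇ n) ∧ (q ≤ᵇ a) ∧ (r ≤ᵇ b) ∧ (t ≤ᵇ c)) (f (n ∸ p) (a ∸ q) (b ∸ r) (c ∸ t))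

Σ<-zero : ∀ m h → (∀ i → h i ≡ 0ℤ) → ℤ[[1]].Σ< m h ≡ 0ℤ
Σ<-zero m h h≡0 = trans (ℤ[[1]].Σ<-cong m h _ h≡0) (ℤ[[1]].Σ<-0# m)

Σ<-δ : ∀ m p (B : Bool → ℕ → ℤ) → (∀ i → B false i ≡ 0ℤ) →
  ℤ[[1]].Σ< m (λ i → B (i ≡ᵇ p) i) ≡ when (p <ᵇ m) (B true p)
Σ<-δ zero    p       B B0 = refl
Σ<-δ (suc m) zero    B B0 =
  trans (cong (ℤ._+_ (B true 0)) (Σ<-zero m (B false ∘ suc) (B0 ∘ suc))) (ℤ.+-identityʳ _)
Σ<-δ (suc m) (suc p) B B0 =
  trans (cong (λ z → z ℤ.+ ℤ[[1]].Σ< m (λ i → B (i ≡ᵇ p) (suc i))) (B0 0))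
        (trans (ℤ.+-identityˡ _) (Σ<-δ m p (λ β → B β ∘ suc) (B0 ∘ suc)))

Σ≤-δ : ∀ m p (B : Bool → ℕ → ℤ) → (∀ i → B false i ≡ 0ℤ) →
  Σ≤ m (λ i → B (i ≡ᵇ p) i) ≡ when (p ≤ᵇ m) (B true p)
Σ≤-δ m p B B0 = trans (Σ≤≡Σ< m (λ i → B (i ≡ᵇ p) i))
  (trans (Σ<-δ (suc m) p B B0) (cong (λ β → when β (B true p)) (<ᵇ-suc p m)))

Σ≤-const0 : ∀ m {z} → z ≡ 0ℤ → Σ≤ m (λ _ → z) ≡ 0ℤ
Σ≤-const0 m {z} z≡0 = trans (Σ≤≡Σ< m (λ _ → z)) (Σ<-zero (suc m) (λ _ → z) (λ _ → z≡0))

mono-⊛ : ∀ p q r t f → mono p q r t ⊛ f ≐ shift p q r t f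
mono-⊛ p q r t f n a b c = begin
  (mono p q r t ⊛ f) n a b c
    ≡⟨ Ser.*-cong {mono p q r t} {δ} {f} {f} (mono-≡ᵇ p q r t) (λ _ _ _ _ → refl) n a b c ⟩
  Σ≤ n (λ i → Σ≤ a (λ j → Σ≤ b (λ k → Σ≤ c (λ l →
    τ (i ≡ᵇ p) (j ≡ᵇ q) (k ≡ᵇ r) (l ≡ᵇ t) i j k l))))
    ≡⟨ Σ≤-δ n p (λ β i → Σ≤ a (λ j → Σ≤ b (λ k → Σ≤ c (λ l →
                   τ β (j ≡ᵇ q) (k ≡ᵇ r) (l ≡ᵇ t) i j k l))))
         (λ _ → Σ≤-const0 a (Σ≤-const0 b (Σ≤-const0 c refl))) ⟩
  when (p ≤ᵇ n) (Σ≤ a (λ j → Σ≤ b (λ k → Σ≤ c (λ l →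
    τ true (j ≡ᵇ q) (k ≡ᵇ r) (l ≡ᵇ t) p j k l))))
    ≡⟨ cong (when (p ≤ᵇ n))
         (Σ≤-δ a q (λ β j → Σ≤ b (λ k → Σ≤ c (λ l → τ true β (k ≡ᵇ r) (l ≡ᵇ t) p j k l)))
                   (λ _ → Σ≤-const0 b (Σ≤-const0 c refl))) ⟩
  when (p ≤ᵇ n) (when (q ≤ᵇ a) (Σ≤ b (λ k → Σ≤ c (λ l → τ true true (k ≡ᵇ r) (l ≡ᵇ t) p q k l))))
    ≡⟨ cong (when (p ≤ᵇ n) ∘ when (q ≤ᵇ a))
         (Σ≤-δ b r (λ β k → Σ≤ c (λ l → τ true true β (l ≡ᵇ t) p q k l)) (λ _ → Σ≤-const0 c refl)) ⟩
  when (p ≤ᵇ n) (when (q ≤ᵇ a) (when (r ≤ᵇ b) (Σ≤ c (λ l → τ true true true (l ≡ᵇ t) p q r l))))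
    ≡⟨ cong (when (p ≤ᵇ n) ∘ when (q ≤ᵇ a) ∘ when (r ≤ᵇ b))
         (Σ≤-δ c t (λ β l → τ true true true β p q r l) (λ _ → refl)) ⟩
  when (p ≤ᵇ n) (when (q ≤ᵇ a) (when (r ≤ᵇ b) (when (t ≤ᵇ c) (1ℤ ℤ.* f′))))
    ≡⟨ cong (when (p ≤ᵇ n) ∘ when (q ≤ᵇ a) ∘ when (r ≤ᵇ b) ∘ when (t ≤ᵇ c)) (ℤ.*-identityˡ f′) ⟩
  when (p ≤ᵇ n) (when (q ≤ᵇ a) (when (r ≤ᵇ b) (when (t ≤ᵇ c) f′)))
    ≡⟨ when⁴ (p ≤ᵇ n) (q ≤ᵇ a) (r ≤ᵇ b) (t ≤ᵇ c) f′ ⟨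
  shift p q r t f n a b c ∎
  where
  open ≡.≡-Reasoning
  δ : Series
  δ i j k l = when ((i ≡ᵇ p) ∧ (j ≡ᵇ q) ∧ (k ≡ᵇ r) ∧ (l ≡ᵇ t)) 1ℤ
  τ : Bool → Bool → Bool → Bool → ℕ → ℕ → ℕ → ℕ → ℤ
  τ β₁ β₂ β₃ β₄ i j k l =
    when (β₁ ∧ β₂ ∧ β₃ ∧ β₄) 1ℤ ℤ.* f (n ∸ i) (a ∸ j) (b ∸ k) (c ∸ l)
  f′ : ℤ
  f′ = f (n ∸ p) (a ∸ q) (b ∸ r) (c ∸ t)

shift-mono : ∀ p q r t p′ q′ r′ t′ →
  shift p q r t (mono p′ q′ r′ t′) ≐ mono (p + p′) (q + q′) (r + r′) (t + t′)
shift-mono p q r t p′ q′ r′ t′ n a b c = begin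
  when L (mono p′ q′ r′ t′ (n ∸ p) (a ∸ q) (b ∸ r) (c ∸ t))
    ≡⟨ cong (when L) (mono-≡ᵇ p′ q′ r′ t′ (n ∸ p) (a ∸ q) (b ∸ r) (c ∸ t)) ⟩
  when L (when E 1ℤ)
    ≡⟨ when-∧ L E 1ℤ ⟨
  when (L ∧ E) 1ℤ
    ≡⟨ cong (λ β → when β 1ℤ) L∧E ⟩
  when ((n ≡ᵇ p + p′) ∧ (a ≡ᵇ q + q′) ∧ (b ≡ᵇ r + r′) ∧ (c ≡ᵇ t + t′)) 1ℤ
    ≡⟨ mono-≡ᵇ (p + p′) (q + q′) (r + r′) (t + t′) n a b c ⟨
  mono (p + p′) (q + q′) (r + r′) (t + t′) n a b c ∎
  where
  open ≡.≡-Reasoning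
  L E : Bool
  L = (p ≤ᵇ n) ∧ (q ≤ᵇ a) ∧ (r ≤ᵇ b) ∧ (t ≤ᵇ c)
  E = (n ∸ p ≡ᵇ p′) ∧ (a ∸ q ≡ᵇ q′) ∧ (b ∸ r ≡ᵇ r′) ∧ (c ∸ t ≡ᵇ t′)
  L∧E : L ∧ E ≡ (n ≡ᵇ p + p′) ∧ (a ≡ᵇ q + q′) ∧ (b ≡ᵇ r + r′) ∧ (c ≡ᵇ t + t′)
  L∧E = trans (∧-zip⁴ (p ≤ᵇ n) (q ≤ᵇ a) (r ≤ᵇ b) (t ≤ᵇ c) _ _ _ _)
    (cong₂ _∧_ (≤ᵇ∧∸≡ᵇ p n p′)
      (cong₂ _∧_ (≤ᵇ∧∸≡ᵇ q a q′) (cong₂ _∧_ (≤ᵇ∧∸≡ᵇ r b r′) (≤ᵇ∧∸≡ᵇ t c t′))))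

mono-⊛-mono : ∀ p q r t p′ q′ r′ t′ →
  mono p q r t ⊛ mono p′ q′ r′ t′ ≐ mono (p + p′) (q + q′) (r + r′) (t + t′)
mono-⊛-mono p q r t p′ q′ r′ t′ = Ser.trans (mono-⊛ p q r t _) (shift-mono p q r t p′ q′ r′ t′)

shift-cong : ∀ p q r t {f g} → f ≐ g → shift p q r t f ≐ shift p q r t g
shift-cong p q r t f≐g n a b c =
  cong (when ((p ≤ᵇ n) ∧ (q ≤ᵇ a) ∧ (r ≤ᵇ b) ∧ (t ≤ᵇ c))) (f≐g (n ∸ p) (a ∸ q) (b ∸ r) (c ∸ t))


-- Geometric series
any-true : ∀ (P : ℕ → Bool) {j} ks → j ∈ ks → P j ≡ true → any P ks ≡ true
any-true P (k ∷ ks) (here refl) Pj = cong (_∨ any P ks) Pj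
any-true P (k ∷ ks) (there j∈) Pj = trans (cong (P k ∨_) (any-true P ks j∈ Pj)) (∨-zeroʳ (P k))

any-false : ∀ (P : ℕ → Bool) ks → (∀ k → P k ≡ false) → any P ks ≡ false
any-false P []       P≡false = refl
any-false P (k ∷ ks) P≡false = cong₂ _∨_ (P≡false k) (any-false P ks P≡false)

any-unique : ∀ (P : ℕ → Bool) {j} ks → j ∈ ks → (∀ k → P k ≡ true → k ≡ j) → any P ks ≡ P j
any-unique P {j} ks j∈ unique with P j in Pj
... | true  = any-true P ks j∈ Pj
... | false = any-false P ks P≡false
  where
  P≡false : ∀ k → P k ≡ false
  P≡false k with P k in Pk
  ... | true  = trans (sym Pk) (trans (cong P (unique k Pk)) Pj)
  ... | false = refl

isPower : (p q r t n a b c k : ℕ) → Bool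
isPower p q r t n a b c k = (n == k * p) ∧ (a == k * q) ∧ (b == k * r) ∧ (c == k * suc t)

-- geo looks for the exponent k with a function local to its where block; unification names it
mutual
  geo-search : (p q r t n a b c : ℕ) → List ℕ → Bool
  geo-search = _

  geo≡search : ∀ p q r t n a b c →
    geo p q r t n a b c ≡ when (isPower p q r t n a b c 0 ∨ geo-search p q r t n a b c (applyUpTo suc c)) 1ℤ
  geo≡search p q r t n a b c with applyUpTo suc c
  ... | ks = refl

geo-search≡any : ∀ p q r t n a b c ks → geo-search p q r t n a b c ks ≡ any (isPower p q r t n a b c) ks
geo-search≡any p q r t n a b c []       = refl
geo-search≡any p q r t n a b c (k ∷ ks) = cong (isPower p q r t n a b c k ∨_) (geo-search≡any p q r t n a b c ks)

geo-closed : ∀ p q r n a b c → geo p q r 0 n a b c ≡ mono (c * p) (c * q) (c * r) (c * 1) n a b c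
geo-closed p q r n a b c = trans (geo≡search p q r 0 n a b c) (cong (λ β → when β 1ℤ)
  (trans (cong (isPower p q r 0 n a b c 0 ∨_) (geo-search≡any p q r 0 n a b c (applyUpTo suc c)))
         (any-unique (isPower p q r 0 n a b c) (upTo (suc c)) (∈-upTo⁺ (n<1+n c)) power-of-c)))
  where
  power-of-c : ∀ k → isPower p q r 0 n a b c k ≡ true → k ≡ c
  power-of-c k isPow = sym (trans (==-sound c (k * 1) c==k) (*-identityʳ k))
    where c==k = ∧-conicalʳ (b == k * r) _ (∧-conicalʳ (a == k * q) _ (∧-conicalʳ (n == k * p) _ isPow))

1#≐mono⁰ : Ser.1# ≐ mono 0 0 0 0
1#≐mono⁰ (suc n) a       b       c       = refl
1#≐mono⁰ zero    (suc a) b       c       = refl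
1#≐mono⁰ zero    zero    (suc b) c       = refl
1#≐mono⁰ zero    zero    zero    (suc c) = refl
1#≐mono⁰ zero    zero    zero    zero    = refl

1#-at-u^suc : ∀ n a b c → Ser.1# n a b (suc c) ≡ 0ℤ
1#-at-u^suc (suc n) a       b       c = refl
1#-at-u^suc zero    (suc a) b       c = refl
1#-at-u^suc zero    zero    (suc b) c = refl
1#-at-u^suc zero    zero    zero    c = refl

shift-at-u⁰ : ∀ p q r t f n a b → shift p q r (suc t) f n a b 0 ≡ 0ℤ
shift-at-u⁰ p q r t f n a b rewrite ∧-zeroʳ (r ≤ᵇ b) | ∧-zeroʳ (q ≤ᵇ a) | ∧-zeroʳ (p ≤ᵇ n) = refl

geo-recurrence : ∀ p q r → geo p q r 0 ≐ Ser.1# ⊕ mono p q r 1 ⊛ geo p q r 0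
geo-recurrence p q r n a b zero = begin
  geo p q r 0 n a b 0
    ≡⟨ geo-closed p q r n a b 0 ⟩
  mono 0 0 0 0 n a b 0
    ≡⟨ trans (ℤ.+-identityʳ _) (1#≐mono⁰ n a b 0) ⟨
  Ser.1# n a b 0 ℤ.+ 0ℤ
    ≡⟨ cong (ℤ._+_ (Ser.1# n a b 0)) (shift-at-u⁰ p q r 0 (geo p q r 0) n a b) ⟨
  Ser.1# n a b 0 ℤ.+ shift p q r 1 (geo p q r 0) n a b 0
    ≡⟨ cong (ℤ._+_ (Ser.1# n a b 0)) (mono-⊛ p q r 1 (geo p q r 0) n a b 0) ⟨
  (Ser.1# ⊕ mono p q r 1 ⊛ geo p q r 0) n a b 0 ∎
  where open ≡.≡-Reasoning
geo-recurrence p q r n a b (suc c) = begin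
  geo p q r 0 n a b (suc c)
    ≡⟨ geo-closed p q r n a b (suc c) ⟩
  mono (p + c * p) (q + c * q) (r + c * r) (1 + c * 1) n a b (suc c)
    ≡⟨ shift-mono p q r 1 (c * p) (c * q) (c * r) (c * 1) n a b (suc c) ⟨
  shift p q r 1 (mono (c * p) (c * q) (c * r) (c * 1)) n a b (suc c)
    ≡⟨ cong (when ((p ≤ᵇ n) ∧ (q ≤ᵇ a) ∧ (r ≤ᵇ b) ∧ true))
            (geo-closed p q r (n ∸ p) (a ∸ q) (b ∸ r) c) ⟨
  shift p q r 1 (geo p q r 0) n a b (suc c)
    ≡⟨ ℤ.+-identityˡ _ ⟨
  0ℤ ℤ.+ shift p q r 1 (geo p q r 0) n a b (suc c)
    ≡⟨ cong₂ ℤ._+_ (1#-at-u^suc n a b c) (mono-⊛ p q r 1 (geo p q r 0) n a b (suc c)) ⟨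
  (Ser.1# ⊕ mono p q r 1 ⊛ geo p q r 0) n a b (suc c) ∎
  where open ≡.≡-Reasoning


swap-mono : ∀ p q r t n a b c → mono p q r t n b a c ≡ mono p r q t n a b c
swap-mono p q r t n a b c = cong (λ β → when β 1ℤ) (∧-swap-middle (n == p) (b == q) (a == r) (c == t))

swap-shift : ∀ p q r t f n a b c → shift p q r t f n b a c ≡ shift p r q t (swapYZ f) n a b c
swap-shift p q r t f n a b c = cong (λ β → when β (f (n ∸ p) (b ∸ q) (a ∸ r) (c ∸ t)))
                                    (∧-swap-middle (p ≤ᵇ n) (q ≤ᵇ b) (r ≤ᵇ a) (t ≤ᵇ c))

-- f(x, y, z, yu) and f(x, y, z, zu)
substY substZ : Series → Series
substY f n a b c = when (c ≤ᵇ a) (f n (a ∸ c) b c)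
substZ f n a b c = when (c ≤ᵇ b) (f n a (b ∸ c) c)

substQ-when : ∀ f n a b c → substQ f n a b c ≡ when ((c ≤ᵇ a) ∧ (c ≤ᵇ b)) (f n (a ∸ c) (b ∸ c) c)
substQ-when f n a b c with c ≤? a | c ≤? b
... | yes c≤a | yes c≤b =
  sym (cong₂ (λ β γ → when (β ∧ γ) (f n (a ∸ c) (b ∸ c) c))
             (dec-true (c ≤? a) c≤a) (dec-true (c ≤? b) c≤b))
... | yes c≤a | no  c≰b =
  sym (cong₂ (λ β γ → when (β ∧ γ) (f n (a ∸ c) (b ∸ c) c))
             (dec-true (c ≤? a) c≤a) (dec-false (c ≤? b) c≰b))
... | no  c≰a | _       =
  sym (cong (λ β → when (β ∧ (c ≤ᵇ b)) (f n (a ∸ c) (b ∸ c) c)) (dec-false (c ≤? a) c≰a))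

substY∘substZ : ∀ f → substY (substZ f) ≐ substQ f
substY∘substZ f n a b c = trans (sym (when-∧ (c ≤ᵇ a) (c ≤ᵇ b) _)) (sym (substQ-when f n a b c))

swap-substQ : ∀ f n a b c → substQ f n b a c ≡ substQ (swapYZ f) n a b c
swap-substQ f n a b c = trans (substQ-when f n b a c)
  (trans (cong (λ β → when β (f n (b ∸ c) (a ∸ c) c)) (∧-comm (c ≤ᵇ b) (c ≤ᵇ a)))
         (sym (substQ-when (swapYZ f) n a b c)))

substY-F1 : substY F1 ≐ F1
substY-F1 n a b zero    = refl
substY-F1 n a b (suc c) = when-zero (suc c ≤ᵇ a)

substY-shift : ∀ p q r t f → substY (shift p q r t f) ≐ shift p (t + q) r t (substY f)
substY-shift p q r t f n a b c = begin
  when (c ≤ᵇ a) (when (P ∧ (q ≤ᵇ a ∸ c) ∧ R ∧ T) v)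
    ≡⟨ when-∧ (c ≤ᵇ a) _ v ⟨
  when ((c ≤ᵇ a) ∧ (P ∧ (q ≤ᵇ a ∸ c) ∧ R ∧ T)) v
    ≡⟨ cong (λ β → when β v) (∧-shuffle (c ≤ᵇ a) P (q ≤ᵇ a ∸ c) R T) ⟩
  when (T ∧ P ∧ R ∧ (c ≤ᵇ a) ∧ (q ≤ᵇ a ∸ c)) v
    ≡⟨ trans (when⁴ T P R _ v) (cong (when T ∘ when P ∘ when R) (when-∧ (c ≤ᵇ a) _ v)) ⟩
  when T (when P (when R (when (c ≤ᵇ a) (when (q ≤ᵇ a ∸ c) v))))
    ≡⟨ cong (when T ∘ when P ∘ when R) (when-≤ᵇ-∸ c q a (λ a′ → f N a′ B (c ∸ t))) ⟩
  guarded (c + q)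
    ≡⟨ when-cong-true T (λ T≡true → cong guarded′ (exponent (≤ᵇ-sound t c T≡true))) ⟩
  guarded (t + q + (c ∸ t))
    ≡⟨ cong (when T ∘ when P ∘ when R) (when-≤ᵇ-∸ (t + q) (c ∸ t) a (λ a′ → f N a′ B (c ∸ t))) ⟨
  when T (when P (when R (when (t + q ≤ᵇ a) (when (c ∸ t ≤ᵇ a ∸ (t + q)) v′))))
    ≡⟨ trans (when⁴ T P R _ v′) (cong (when T ∘ when P ∘ when R) (when-∧ (t + q ≤ᵇ a) _ v′)) ⟨
  when (T ∧ P ∧ R ∧ (t + q ≤ᵇ a) ∧ (c ∸ t ≤ᵇ a ∸ (t + q))) v′
    ≡⟨ cong (λ β → when β v′) (∧-Solver.solve 5 (λ p q r t e → (p & q & r & t) & e ⊜ t & p & r & q & e) refl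
                                                P (t + q ≤ᵇ a) R T (c ∸ t ≤ᵇ a ∸ (t + q))) ⟨
  when ((P ∧ (t + q ≤ᵇ a) ∧ R ∧ T) ∧ (c ∸ t ≤ᵇ a ∸ (t + q))) v′
    ≡⟨ when-∧ (P ∧ (t + q ≤ᵇ a) ∧ R ∧ T) _ v′ ⟩
  shift p (t + q) r t (substY f) n a b c ∎
  where
  open ≡.≡-Reasoning
  open ∧-Solver using (_⊜_) renaming (_⊕_ to _&_)
  P R T : Bool
  P = p ≤ᵇ n
  R = r ≤ᵇ b
  T = t ≤ᵇ c
  N B : ℕ
  N = n ∸ p
  B = b ∸ r
  v v′ : ℤ
  v  = f N (a ∸ c ∸ q) B (c ∸ t)
  v′ = f N (a ∸ (t + q) ∸ (c ∸ t)) B (c ∸ t)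
  guarded′ : ℕ → ℤ
  guarded′ x = when P (when R (when (x ≤ᵇ a) (f N (a ∸ x) B (c ∸ t))))
  guarded : ℕ → ℤ
  guarded x = when T (guarded′ x)
  exponent : t ≤ c → c + q ≡ t + q + (c ∸ t)
  exponent t≤c = begin
    c + q               ≡⟨ +-comm c q ⟩
    q + c               ≡⟨ cong (_+_ q) (m+[n∸m]≡n t≤c) ⟨
    q + (t + (c ∸ t))   ≡⟨ +-assoc q t (c ∸ t) ⟨
    q + t + (c ∸ t)     ≡⟨ cong (_+ (c ∸ t)) (+-comm q t) ⟩
    t + q + (c ∸ t)     ∎

substY-mono : ∀ p q r t → substY (mono p q r t) ≐ mono p (t + q) r t
substY-mono p q r t n a b c = begin
  when (c ≤ᵇ a) (mono p q r t n (a ∸ c) b c)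
    ≡⟨ cong (when (c ≤ᵇ a)) (mono-≡ᵇ p q r t n (a ∸ c) b c) ⟩
  when (c ≤ᵇ a) (when (N ∧ (a ∸ c ≡ᵇ q) ∧ B ∧ C) 1ℤ)
    ≡⟨ when-∧ (c ≤ᵇ a) _ 1ℤ ⟨
  when ((c ≤ᵇ a) ∧ (N ∧ (a ∸ c ≡ᵇ q) ∧ B ∧ C)) 1ℤ
    ≡⟨ cong (λ β → when β 1ℤ) (trans (∧-shuffle (c ≤ᵇ a) N _ B C)
                                   (cong (λ β → C ∧ N ∧ B ∧ β) (≤ᵇ∧∸≡ᵇ c a q))) ⟩
  when (C ∧ N ∧ B ∧ (a ≡ᵇ c + q)) 1ℤ
    ≡⟨ trans (when-∧ C _ 1ℤ) (when-cong-true C (λ C≡true →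
         cong (λ x → when (N ∧ B ∧ (a ≡ᵇ x + q)) 1ℤ) (≡ᵇ⇒≡ c t (Equivalence.from T-≡ C≡true)))) ⟩
  when C (when (N ∧ B ∧ (a ≡ᵇ t + q)) 1ℤ)
    ≡⟨ when-∧ C _ 1ℤ ⟨
  when (C ∧ N ∧ B ∧ (a ≡ᵇ t + q)) 1ℤ
    ≡⟨ cong (λ β → when β 1ℤ) (∧-Solver.solve 4 (λ t p r q → t & p & r & q ⊜ p & q & r & t) refl C N B _) ⟩
  when (N ∧ (a ≡ᵇ t + q) ∧ B ∧ C) 1ℤ
    ≡⟨ mono-≡ᵇ p (t + q) r t n a b c ⟨
  mono p (t + q) r t n a b c ∎
  where
  open ≡.≡-Reasoning
  open ∧-Solver using (_⊜_) renaming (_⊕_ to _&_)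
  N B C : Bool
  N = n ≡ᵇ p
  B = b ≡ᵇ r
  C = c ≡ᵇ t


-- Recurrences of the shape of Lemma 5.2

X : ℕ → ℕ → Series
X q r = mono 1 q r 1

Y : ℕ → ℕ → Series
Y q′ r′ = mono 0 q′ r′ 1

-- Y f + X (1 − Y) + X h − X Y s,  where  X = x y^q z^r u  and  Y = y^q′ z^r′ u
recurrence-rhs : (q r q′ r′ : ℕ) (f h s : Series) → Series
recurrence-rhs q r q′ r′ f h s = shift 0 q′ r′ 1 f ⊕ (mono 1 q r 1 ⊖ mono 1 (q + q′) (r + r′) 2
                                                     ⊕ (shift 1 q r 1 h ⊖ shift 1 (q + q′) (r + r′) 2 s))

record Recurrence (q r q′ r′ : ℕ) (f h s : Series) : Set where
  constructor recurrence
  field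
    unfold : f ≐ recurrence-rhs q r q′ r′ f h s

recurrence-swap : ∀ {q r q′ r′ f h s} → Recurrence q r q′ r′ f h s →
  Recurrence r q r′ q′ (swapYZ f) (swapYZ h) (swapYZ s)
recurrence-swap {q} {r} {q′} {r′} {f} {h} {s} (recurrence rec) = recurrence λ n a b c → trans (rec n b a c)
  (cong₂ ℤ._+_ (swap-shift 0 q′ r′ 1 f n a b c)
    (cong₂ ℤ._+_ (cong₂ ℤ._-_ (swap-mono 1 q r 1 n a b c) (swap-mono 1 (q + q′) (r + r′) 2 n a b c))
                 (cong₂ ℤ._-_ (swap-shift 1 q r 1 h n a b c) (swap-shift 1 (q + q′) (r + r′) 2 s n a b c))))

when-distrib : ∀ β u v w x y →
  when β (u ℤ.+ (v ℤ.- w ℤ.+ (x ℤ.- y)))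
    ≡ when β u ℤ.+ (when β v ℤ.- when β w ℤ.+ (when β x ℤ.- when β y))
when-distrib false u v w x y = refl
when-distrib true  u v w x y = refl

recurrence-substY : ∀ {q r q′ r′ f h s} → Recurrence q r q′ r′ f h s →
  Recurrence (suc q) r (suc q′) r′ (substY f) (substY h) (substY s)
recurrence-substY {q} {r} {q′} {r′} {f} {h} {s} (recurrence rec) = recurrence λ n a b c →
  trans (cong (when (c ≤ᵇ a)) (rec n (a ∸ c) b c)) (trans (when-distrib (c ≤ᵇ a) _ _ _ _ _)
    (cong₂ ℤ._+_ (substY-shift 0 q′ r′ 1 f n a b c)
      (cong₂ ℤ._+_ (cong₂ ℤ._-_ (substY-mono 1 q r 1 n a b c)
                                (trans (substY-mono 1 (q + q′) (r + r′) 2 n a b c)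
                                       (cong (λ k → mono 1 k (r + r′) 2 n a b c) exponent)))
                   (cong₂ ℤ._-_ (substY-shift 1 q r 1 h n a b c)
                                (trans (substY-shift 1 (q + q′) (r + r′) 2 s n a b c)
                                       (cong (λ k → shift 1 k (r + r′) 2 (substY s) n a b c) exponent))))))
  where
  exponent : 2 + (q + q′) ≡ suc q + suc q′
  exponent = cong suc (sym (+-suc q q′))

recurrence-cong : ∀ {q r q′ r′ f h h′ s s′} → h ≐ h′ → s ≐ s′ →
  Recurrence q r q′ r′ f h s → Recurrence q r q′ r′ f h′ s′
recurrence-cong {q} {r} {q′} {r′} {f} {h} {h′} {s} {s′} h≐h′ s≐s′ (recurrence rec) =
  recurrence λ n a b c → trans (rec n a b c) (cong (ℤ._+_ (shift 0 q′ r′ 1 f n a b c))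
    (cong (ℤ._+_ (mono 1 q r 1 n a b c ℤ.- mono 1 (q + q′) (r + r′) 2 n a b c))
      (cong₂ ℤ._-_ (shift-cong 1 q r 1 h≐h′ n a b c) (shift-cong 1 (q + q′) (r + r′) 2 s≐s′ n a b c))))

open LinearRecurrences seriesRing using (recurrence-solution; nested-recurrence-solution)
open Ser using (_-_)

recurrence-closed-form : ∀ {q r q′ r′ f h s} → Recurrence q r q′ r′ f h s →
  f ≐ X q r ⊕ geo 0 q′ r′ 0 ⊛ (X q r ⊛ h - X q r ⊛ Y q′ r′ ⊛ s)
recurrence-closed-form {q} {r} {q′} {r′} {f} {h} {s} (recurrence rec) =
  recurrence-solution {f} {geo 0 q′ r′ 0} {Y q′ r′} {X q r} {X q r ⊛ h - X q r ⊛ Y q′ r′ ⊛ s}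
                      (geo-recurrence 0 q′ r′) ring-form
  where
  XY≐X⊛Y : mono 1 (q + q′) (r + r′) 2 ≐ X q r ⊛ Y q′ r′
  XY≐X⊛Y = Ser.sym (mono-⊛-mono 1 q r 1 0 q′ r′ 1)
  ring-form : f ≐ Y q′ r′ ⊛ f ⊕ (X q r - X q r ⊛ Y q′ r′ ⊕ (X q r ⊛ h - X q r ⊛ Y q′ r′ ⊛ s))
  ring-form n a b c = trans (rec n a b c)
    (cong₂ ℤ._+_ (sym (mono-⊛ 0 q′ r′ 1 f n a b c))
      (cong₂ ℤ._+_ (cong (ℤ._-_ (X q r n a b c)) (XY≐X⊛Y n a b c))
                   (cong₂ ℤ._-_ (sym (mono-⊛ 1 q r 1 h n a b c))
                                (trans (sym (mono-⊛ 1 (q + q′) (r + r′) 2 s n a b c))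
                                       (Ser.*-congʳ {s} {mono 1 (q + q′) (r + r′) 2} XY≐X⊛Y n a b c)))))

nested-closed-form : ∀ {q r f h s h′ s′} → Recurrence q r q r f h s → Recurrence 1 1 1 1 s h′ s′ →
  f ≐ X q r ⊕ X q r ⊛ geo 0 q r 0 ⊛ h
      - mono 2 (q + q + 1) (r + r + 1) 3 ⊛ geo 0 q r 0
      - mono 2 (q + q + 1) (r + r + 1) 3 ⊛ geo 0 q r 0 ⊛ geo 0 1 1 0 ⊛ h′
      ⊕ mono 2 (q + q + 1 + 1) (r + r + 1 + 1) 4 ⊛ geo 0 q r 0 ⊛ geo 0 1 1 0 ⊛ s′
nested-closed-form {q} {r} {f} {h} {s} {h′} {s′} f-rec s-rec =
  nested-recurrence-solution {f} {s} {s′} {h} {h′} {X q r} {Y q r} {X 1 1} {Y 1 1} {geo 0 q r 0} {geo 0 1 1 0}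
                             {mono 2 (q + q + 1) (r + r + 1) 3} {mono 2 (q + q + 1 + 1) (r + r + 1 + 1) 4}
    (recurrence-closed-form f-rec) (recurrence-closed-form s-rec)
    M₃≐ M₄≐
  where
  M₃≐ : mono 2 (q + q + 1) (r + r + 1) 3 ≐ X q r ⊛ Y q r ⊛ X 1 1
  M₃≐ = Ser.sym (Ser.trans (Ser.*-congʳ {X 1 1} {X q r ⊛ Y q r} (mono-⊛-mono 1 q r 1 0 q r 1))
                           (mono-⊛-mono 1 (q + q) (r + r) 2 1 1 1 1))
  M₄≐ : mono 2 (q + q + 1 + 1) (r + r + 1 + 1) 4 ≐ mono 2 (q + q + 1) (r + r + 1) 3 ⊛ Y 1 1
  M₄≐ = Ser.sym (mono-⊛-mono 2 (q + q + 1) (r + r + 1) 3 0 1 1 1)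


-- Catalan words
∑ : {A : Set} → List A → (A → ℤ) → ℤ
∑ []       f = 0ℤ
∑ (x ∷ xs) f = f x ℤ.+ ∑ xs f

∑-cong : ∀ {A : Set} (xs : List A) {f g : A → ℤ} → (∀ x → f x ≡ g x) → ∑ xs f ≡ ∑ xs g
∑-cong []       f≡g = refl
∑-cong (x ∷ xs) f≡g = cong₂ ℤ._+_ (f≡g x) (∑-cong xs f≡g)

∑-zero : ∀ {A : Set} (xs : List A) {f : A → ℤ} → (∀ x → f x ≡ 0ℤ) → ∑ xs f ≡ 0ℤ
∑-zero []       f≡0 = refl
∑-zero (x ∷ xs) f≡0 = cong₂ ℤ._+_ (f≡0 x) (∑-zero xs f≡0)

∑-++ : ∀ {A : Set} (xs ys : List A) f → ∑ (xs ++ ys) f ≡ ∑ xs f ℤ.+ ∑ ys f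
∑-++ []       ys f = sym (ℤ.+-identityˡ (∑ ys f))
∑-++ (x ∷ xs) ys f = trans (cong (ℤ._+_ (f x)) (∑-++ xs ys f)) (sym (ℤ.+-assoc (f x) _ _))

∑-concatMap : ∀ {A B : Set} (g : A → List B) xs f → ∑ (concatMap g xs) f ≡ ∑ xs (λ x → ∑ (g x) f)
∑-concatMap g []       f = refl
∑-concatMap g (x ∷ xs) f =
  trans (∑-++ (g x) (concatMap g xs) f) (cong (ℤ._+_ (∑ (g x) f)) (∑-concatMap g xs f))

∑-map : ∀ {A B : Set} (g : A → B) xs f → ∑ (map g xs) f ≡ ∑ xs (f ∘ g)
∑-map g []       f = refl
∑-map g (x ∷ xs) f = cong (ℤ._+_ (f (g x))) (∑-map g xs f)

∑-applyUpTo : ∀ (g : ℕ → ℕ) n h → ∑ (applyUpTo g n) h ≡ ℤ[[1]].Σ< n (h ∘ g)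
∑-applyUpTo g zero    h = refl
∑-applyUpTo g (suc n) h = cong (ℤ._+_ (h (g 0))) (∑-applyUpTo (g ∘ suc) n h)

∑-+ : ∀ {A : Set} (xs : List A) f g → ∑ xs (λ x → f x ℤ.+ g x) ≡ ∑ xs f ℤ.+ ∑ xs g
∑-+ []       f g = refl
∑-+ (x ∷ xs) f g =
  trans (cong (ℤ._+_ (f x ℤ.+ g x)) (∑-+ xs f g)) (+-interchange (f x) (g x) (∑ xs f) (∑ xs g))

∑-neg : ∀ {A : Set} (xs : List A) f → ∑ xs (λ x → ℤ.- f x) ≡ ℤ.- ∑ xs f
∑-neg []       f = refl
∑-neg (x ∷ xs) f = trans (cong (ℤ._+_ (ℤ.- f x)) (∑-neg xs f)) (sym (ℤ.neg-distrib-+ (f x) (∑ xs f)))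

∑-minus : ∀ {A : Set} (xs : List A) f g → ∑ xs (λ x → f x ℤ.- g x) ≡ ∑ xs f ℤ.- ∑ xs g
∑-minus xs f g = trans (∑-+ xs f (λ x → ℤ.- g x)) (cong (ℤ._+_ (∑ xs f)) (∑-neg xs g))

when-∑ : ∀ {A : Set} β (xs : List A) f → when β (∑ xs f) ≡ ∑ xs (λ x → when β (f x))
when-∑ true  xs f = refl
when-∑ false xs f = sym (∑-zero xs (λ _ → refl))

isOdd-suc : ∀ n → isOdd (suc n) ≡ not (isOdd n)
isOdd-suc zero    = refl
isOdd-suc (suc n) = trans (sym (not-involutive (isOdd n))) (cong not (sym (isOdd-suc n)))

length-snoc : ∀ (w : List ℕ) k → length (w ++ [ k ]) ≡ suc (length w)
length-snoc w k = trans (length-++ w) (+-comm (length w) 1)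

lastLetter-snoc : ∀ w k → lastLetter (w ++ [ k ]) ≡ k
lastLetter-snoc []           k = refl
lastLetter-snoc (x ∷ [])     k = refl
lastLetter-snoc (x ∷ y ∷ ys) k = lastLetter-snoc (y ∷ ys) k

mutual
  oddCells-snoc : ∀ w k →
    oddCells (w ++ [ k ]) ≡ (if isOdd (length w) then oddCells w else oddCells w + suc k)
  oddCells-snoc []      k = +-identityʳ (suc k)
  oddCells-snoc (x ∷ w) k rewrite evenCells-snoc w k | isOdd-suc (length w) with isOdd (length w)
  ... | true  = sym (+-assoc (suc x) (evenCells w) (suc k))
  ... | false = refl

  evenCells-snoc : ∀ w k →
    evenCells (w ++ [ k ]) ≡ (if isOdd (length w) then evenCells w + suc k else evenCells w)
  evenCells-snoc []      k = refl
  evenCells-snoc (x ∷ w) k rewrite oddCells-snoc w k | isOdd-suc (length w) with isOdd (length w)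
  ... | true  = refl
  ... | false = refl

s-snoc : ∀ w k → s (w ++ [ k ]) ≡ suc k + sbar w
s-snoc w k rewrite length-snoc w k | isOdd-suc (length w) | oddCells-snoc w k | evenCells-snoc w k
  with isOdd (length w)
... | true  = +-comm (evenCells w) (suc k)
... | false = +-comm (oddCells w) (suc k)

sbar-snoc : ∀ w k → sbar (w ++ [ k ]) ≡ s w
sbar-snoc w k rewrite length-snoc w k | isOdd-suc (length w) | oddCells-snoc w k | evenCells-snoc w k
  with isOdd (length w)
... | true  = refl
... | false = refl

count-∑ : ∀ (P : List ℕ → Bool) ws → ℤ.+ (count P ws) ≡ ∑ ws (λ w → when (P w) 1ℤ)
count-∑ P []       = refl
count-∑ P (w ∷ ws) with P w
... | true  = cong (ℤ._+_ 1ℤ) (count-∑ P ws)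
... | false = trans (count-∑ P ws) (sym (ℤ.+-identityˡ _))

hasStats : List ℕ → ℕ → ℕ → ℕ → Bool
hasStats w a b c = (s w ≡ᵇ a) ∧ (sbar w ≡ᵇ b) ∧ (last w ≡ᵇ c)

F-∑ : ∀ n a b c → F n a b c ≡ ∑ (catWords n) (λ w → when (hasStats w a b c) 1ℤ)
F-∑ n a b c = trans (count-∑ (λ w → (s w == a) ∧ (sbar w == b) ∧ (last w == c)) (catWords n))
  (∑-cong (catWords n) λ w → cong (λ β → when β 1ℤ)
    (cong₂ _∧_ (==⇒≡ᵇ (s w) a) (cong₂ _∧_ (==⇒≡ᵇ (sbar w) b) (==⇒≡ᵇ (last w) c))))

G1-term : List ℕ → ℕ → ℕ → ℕ → ℤ
G1-term w a b zero    = when ((s w ≡ᵇ b) ∧ (sbar w ≡ᵇ a)) 1ℤ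
G1-term w a b (suc c) = 0ℤ

G1-∑ : ∀ n a b c → G1 n a b c ≡ ∑ (catWords n) (λ w → G1-term w a b c)
G1-∑ n a b zero    = trans (count-∑ (λ w → (s w == b) ∧ (sbar w == a)) (catWords n))
  (∑-cong (catWords n) λ w → cong (λ β → when β 1ℤ) (cong₂ _∧_ (==⇒≡ᵇ (s w) b) (==⇒≡ᵇ (sbar w) a)))
G1-∑ n a b (suc c) = sym (∑-zero (catWords n) (λ _ → refl))

substY-G-term : List ℕ → ℕ → ℕ → ℕ → ℤ
substY-G-term w a b c = when (c ≤ᵇ a) (when (hasStats w b (a ∸ c) c) 1ℤ)

substY-G-∑ : ∀ n a b c → substY G n a b c ≡ ∑ (catWords n) (λ w → substY-G-term w a b c)
substY-G-∑ n a b c = trans (cong (when (c ≤ᵇ a)) (F-∑ n b (a ∸ c) c))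
                           (when-∑ (c ≤ᵇ a) (catWords n) (λ w → when (hasStats w b (a ∸ c) c) 1ℤ))

-- the part of the coefficient of y^a z^b u^c in F coming from the one-letter extensions of w
extensions : List ℕ → ℕ → ℕ → ℕ → ℤ
extensions w a b c = ∑ (upTo (suc (suc (lastLetter w)))) (λ k → when (hasStats (w ++ [ k ]) a b c) 1ℤ)

F-extensions : ∀ m a b c → F (suc (suc m)) a b c ≡ ∑ (catWords (suc m)) (λ w → extensions w a b c)
F-extensions m a b c = trans (F-∑ (suc (suc m)) a b c)
  (trans (∑-concatMap extend (catWords (suc m)) indicator)
         (∑-cong (catWords (suc m)) (λ w → ∑-map (λ k → w ++ [ k ]) (upTo (suc (suc (lastLetter w)))) indicator)))
  where
  indicator : List ℕ → ℤ
  indicator w = when (hasStats w a b c) 1ℤ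
  extend : List ℕ → List (List ℕ)
  extend w = map (λ k → w ++ [ k ]) (upTo (suc (suc (lastLetter w))))

hasStats-snoc : ∀ w k a b c →
  hasStats (w ++ [ k ]) a b c ≡ (suc k + sbar w ≡ᵇ a) ∧ (s w ≡ᵇ b) ∧ (suc k ≡ᵇ c)
hasStats-snoc w k a b c rewrite s-snoc w k | sbar-snoc w k | lastLetter-snoc w k = refl

when-∧∧false : ∀ x y z → when (x ∧ y ∧ false) z ≡ 0ℤ
when-∧∧false x y z rewrite ∧-zeroʳ y | ∧-zeroʳ x = refl

extensions-u⁰ : ∀ w a b → extensions w a b 0 ≡ 0ℤ
extensions-u⁰ w a b = ∑-zero (upTo (suc (suc (lastLetter w)))) λ k →
  trans (cong (λ β → when β 1ℤ) (hasStats-snoc w k a b 0))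
        (when-∧∧false (suc k + sbar w ≡ᵇ a) (s w ≡ᵇ b) 1ℤ)

extensions-u^suc : ∀ w a b c →
  extensions w a b (suc c) ≡ when (c ≤ᵇ suc (lastLetter w)) (when ((suc c + sbar w ≡ᵇ a) ∧ (s w ≡ᵇ b)) 1ℤ)
extensions-u^suc w a b c = begin
  extensions w a b (suc c)
    ≡⟨ ∑-cong (upTo N) (λ k → cong (λ β → when β 1ℤ) (hasStats-snoc w k a b (suc c))) ⟩
  ∑ (upTo N) (λ k → τ (k ≡ᵇ c) k)
    ≡⟨ ∑-applyUpTo id N (λ k → τ (k ≡ᵇ c) k) ⟩
  ℤ[[1]].Σ< N (λ k → τ (k ≡ᵇ c) k)
    ≡⟨ Σ<-δ N c τ (λ k → when-∧∧false (suc k + sbar w ≡ᵇ a) (s w ≡ᵇ b) 1ℤ) ⟩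
  when (c <ᵇ N) (τ true c)
    ≡⟨ cong₂ when (<ᵇ-suc c (suc (lastLetter w)))
                  (cong (λ β → when ((suc c + sbar w ≡ᵇ a) ∧ β) 1ℤ) (∧-identityʳ (s w ≡ᵇ b))) ⟩
  when (c ≤ᵇ suc (lastLetter w)) (when ((suc c + sbar w ≡ᵇ a) ∧ (s w ≡ᵇ b)) 1ℤ) ∎
  where
  open ≡.≡-Reasoning
  N : ℕ
  N = suc (suc (lastLetter w))
  τ : Bool → ℕ → ℤ
  τ β k = when ((suc k + sbar w ≡ᵇ a) ∧ (s w ≡ᵇ b) ∧ β) 1ℤ

when-≤ᵇ-suc : ∀ c L z → when (c ≤ᵇ L) z ≡ when (c ≤ᵇ suc L) z ℤ.- when (c ≡ᵇ suc L) z
when-≤ᵇ-suc zero          L       z = sym (ℤ.+-identityʳ z)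
when-≤ᵇ-suc (suc zero)    zero    z = sym (ℤ.+-inverseʳ z)
when-≤ᵇ-suc (suc (suc c)) zero    z = refl
when-≤ᵇ-suc (suc c)       (suc L) z = begin
  when (c <ᵇ suc L) z                                ≡⟨ cong (λ β → when β z) (<ᵇ-suc c L) ⟩
  when (c ≤ᵇ L) z                                    ≡⟨ when-≤ᵇ-suc c L z ⟩
  when (c ≤ᵇ suc L) z ℤ.- when (c ≡ᵇ suc L) z
    ≡⟨ cong (λ β → when β z ℤ.- when (c ≡ᵇ suc L) z) (<ᵇ-suc c (suc L)) ⟨
  when (c <ᵇ suc (suc L)) z ℤ.- when (c ≡ᵇ suc L) z  ∎
  where open ≡.≡-Reasoning

when-last-column : ∀ c l σ a t z →
  when (c ≡ᵇ l) (when ((c + σ ≡ᵇ a) ∧ t) z)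
    ≡ when (c ≤ᵇ a) (when (t ∧ (σ ≡ᵇ a ∸ c) ∧ (l ≡ᵇ c)) z)
when-last-column c l σ a t z = begin
  when (c ≡ᵇ l) (when ((c + σ ≡ᵇ a) ∧ t) z)               ≡⟨ when-∧ (c ≡ᵇ l) _ z ⟨
  when ((c ≡ᵇ l) ∧ (c + σ ≡ᵇ a) ∧ t) z                    ≡⟨ cong (λ β → when β z) conjunction ⟩
  when ((c ≤ᵇ a) ∧ t ∧ (σ ≡ᵇ a ∸ c) ∧ (l ≡ᵇ c)) z         ≡⟨ when-∧ (c ≤ᵇ a) _ z ⟩
  when (c ≤ᵇ a) (when (t ∧ (σ ≡ᵇ a ∸ c) ∧ (l ≡ᵇ c)) z)   ∎
  where
  open ≡.≡-Reasoning
  open ∧-Solver using (_⊜_) renaming (_⊕_ to _&_)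
  height : (c + σ ≡ᵇ a) ≡ (c ≤ᵇ a) ∧ (σ ≡ᵇ a ∸ c)
  height = trans (≡ᵇ-sym (c + σ) a)
    (trans (sym (≤ᵇ∧∸≡ᵇ c a σ)) (cong ((c ≤ᵇ a) ∧_) (≡ᵇ-sym (a ∸ c) σ)))
  conjunction : (c ≡ᵇ l) ∧ (c + σ ≡ᵇ a) ∧ t ≡ (c ≤ᵇ a) ∧ t ∧ (σ ≡ᵇ a ∸ c) ∧ (l ≡ᵇ c)
  conjunction = trans (cong₂ (λ e h → e ∧ h ∧ t) (≡ᵇ-sym c l) height)
    (∧-Solver.solve 4 (λ e d m t → e & (d & m) & t ⊜ d & t & m & e) refl
                      (l ≡ᵇ c) (c ≤ᵇ a) (σ ≡ᵇ a ∸ c) t)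

-- Multiplying by yu raises the height of the new column, which ranges over 1 … last w + 1, by one:
-- height 1 is lost (w's term in x y u G(1)) and height last w + 2 is gained (its term in x y u · yu · G(yu)).
extensions-recurrence : ∀ w a b c →
  extensions w a b c ≡ when ((1 ≤ᵇ a) ∧ (1 ≤ᵇ c)) (extensions w (a ∸ 1) b (c ∸ 1))
    ℤ.+ (when ((1 ≤ᵇ a) ∧ (1 ≤ᵇ c)) (G1-term w (a ∸ 1) b (c ∸ 1))
         ℤ.- when ((2 ≤ᵇ a) ∧ (2 ≤ᵇ c)) (substY-G-term w (a ∸ 2) b (c ∸ 2)))
extensions-recurrence w a             b zero
  rewrite extensions-u⁰ w a b | ∧-zeroʳ (1 ≤ᵇ a) | ∧-zeroʳ (2 ≤ᵇ a) = refl
extensions-recurrence w zero          b (suc zero)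
  rewrite extensions-u^suc w zero b zero = refl
extensions-recurrence w (suc a)       b (suc zero)
  rewrite extensions-u^suc w (suc a) b zero | extensions-u⁰ w a b | ∧-zeroʳ (2 ≤ᵇ suc a) =
  trans (cong (λ β → when β 1ℤ) (∧-comm (sbar w ≡ᵇ a) (s w ≡ᵇ b)))
        (sym (trans (ℤ.+-identityˡ _) (ℤ.+-identityʳ _)))
extensions-recurrence w zero          b (suc (suc c))
  rewrite extensions-u^suc w zero b (suc c) = when-zero (suc c ≤ᵇ suc (lastLetter w))
extensions-recurrence w (suc zero)    b (suc (suc c))
  rewrite extensions-u^suc w (suc zero) b (suc c) | extensions-u^suc w zero b c =
  trans (when-zero (suc c ≤ᵇ suc (lastLetter w)))
        (sym (trans (ℤ.+-identityʳ _) (when-zero (c ≤ᵇ suc (lastLetter w)))))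
extensions-recurrence w (suc (suc a)) b (suc (suc c)) = begin
  extensions w (suc (suc a)) b (suc (suc c))     ≡⟨ extensions-u^suc w (suc (suc a)) b (suc c) ⟩
  when (suc c ≤ᵇ suc L) U                        ≡⟨ cong (λ β → when β U) (<ᵇ-suc c L) ⟩
  when (c ≤ᵇ L) U                                ≡⟨ when-≤ᵇ-suc c L U ⟩
  when (c ≤ᵇ suc L) U ℤ.- when (c ≡ᵇ suc L) U
    ≡⟨ cong₂ ℤ._-_ (extensions-u^suc w (suc a) b c) (sym (when-last-column c (suc L) (sbar w) a (s w ≡ᵇ b) 1ℤ)) ⟨
  extensions w (suc a) b (suc c) ℤ.- V
    ≡⟨ cong (ℤ._+_ (extensions w (suc a) b (suc c))) (ℤ.+-identityˡ (ℤ.- V)) ⟨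
  extensions w (suc a) b (suc c) ℤ.+ (0ℤ ℤ.- V)  ∎
  where
  open ≡.≡-Reasoning
  L : ℕ
  L = lastLetter w
  U V : ℤ
  U = when ((c + sbar w ≡ᵇ a) ∧ (s w ≡ᵇ b)) 1ℤ
  V = substY-G-term w a b c

F-length-1 : ∀ a b c → F 1 a b c ≡ mono 1 1 0 1 1 a b c
F-length-1 a b c = begin
  F 1 a b c                                        ≡⟨ F-∑ 1 a b c ⟩
  when ((1 ≡ᵇ a) ∧ (0 ≡ᵇ b) ∧ (1 ≡ᵇ c)) 1ℤ ℤ.+ 0ℤ  ≡⟨ ℤ.+-identityʳ _ ⟩
  when ((1 ≡ᵇ a) ∧ (0 ≡ᵇ b) ∧ (1 ≡ᵇ c)) 1ℤ
    ≡⟨ cong (λ β → when β 1ℤ) (cong₂ _∧_ (≡ᵇ-sym 1 a) (cong₂ _∧_ (≡ᵇ-sym 0 b) (≡ᵇ-sym 1 c))) ⟩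
  when ((a ≡ᵇ 1) ∧ (b ≡ᵇ 0) ∧ (c ≡ᵇ 1)) 1ℤ        ≡⟨ mono-≡ᵇ 1 1 0 1 1 a b c ⟨
  mono 1 1 0 1 1 a b c                             ∎
  where open ≡.≡-Reasoning

x≡y+[x-y+0] : ∀ x y → x ≡ y ℤ.+ (x ℤ.- y ℤ.+ 0ℤ)
x≡y+[x-y+0] = solve-∀

F-unfolds-length-1 : ∀ a b c → F 1 a b c ≡ recurrence-rhs 1 0 1 0 F G1 (substY G) 1 a b c
F-unfolds-length-1 a b c = begin
  F 1 a b c
    ≡⟨ x≡y+[x-y+0] (F 1 a b c) (mono 1 2 0 2 1 a b c) ⟩
  mono 1 2 0 2 1 a b c ℤ.+ (F 1 a b c ℤ.- mono 1 2 0 2 1 a b c ℤ.+ 0ℤ)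
    ≡⟨ cong₂ ℤ._+_ (sym shifted-F)
                   (cong₂ ℤ._+_ (cong (ℤ._- mono 1 2 0 2 1 a b c) (F-length-1 a b c)) (sym no-shorter-words)) ⟩
  recurrence-rhs 1 0 1 0 F G1 (substY G) 1 a b c ∎
  where
  open ≡.≡-Reasoning
  shifted-F : shift 0 1 0 1 F 1 a b c ≡ mono 1 2 0 2 1 a b c
  shifted-F = trans (cong (when ((1 ≤ᵇ a) ∧ (1 ≤ᵇ c))) (F-length-1 (a ∸ 1) b (c ∸ 1)))
                    (shift-mono 0 1 0 1 1 1 0 1 1 a b c)
  no-shorter-words : shift 1 1 0 1 G1 1 a b c ℤ.- shift 1 2 0 2 (substY G) 1 a b c ≡ 0ℤ
  no-shorter-words = cong₂ ℤ._-_
    (trans (cong (when ((1 ≤ᵇ a) ∧ (1 ≤ᵇ c))) (G1-∑ 0 (a ∸ 1) b (c ∸ 1))) (when-zero _))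
    (trans (cong (when ((2 ≤ᵇ a) ∧ (2 ≤ᵇ c))) (substY-G-∑ 0 (a ∸ 2) b (c ∸ 2))) (when-zero _))

F-unfolds-length-2+ : ∀ m a b c → F (suc (suc m)) a b c ≡ recurrence-rhs 1 0 1 0 F G1 (substY G) (suc (suc m)) a b c
F-unfolds-length-2+ m a b c = begin
  F (suc (suc m)) a b c
    ≡⟨ F-extensions m a b c ⟩
  ∑ W (λ w → extensions w a b c)
    ≡⟨ ∑-cong W (λ w → extensions-recurrence w a b c) ⟩
  ∑ W (λ w → when A₁ (ext w) ℤ.+ (when A₁ (g₁ w) ℤ.- when A₂ (gy w)))
    ≡⟨ trans (∑-+ W (λ w → when A₁ (ext w)) _)
             (cong (ℤ._+_ (∑ W (λ w → when A₁ (ext w))))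
                   (∑-minus W (λ w → when A₁ (g₁ w)) (λ w → when A₂ (gy w)))) ⟩
  ∑ W (λ w → when A₁ (ext w)) ℤ.+ (∑ W (λ w → when A₁ (g₁ w)) ℤ.- ∑ W (λ w → when A₂ (gy w)))
    ≡⟨ cong₂ ℤ._+_ (when-∑ A₁ W ext) (cong₂ ℤ._-_ (when-∑ A₁ W g₁) (when-∑ A₂ W gy)) ⟨
  when A₁ (∑ W ext) ℤ.+ (when A₁ (∑ W g₁) ℤ.- when A₂ (∑ W gy))
    ≡⟨ cong₂ ℤ._+_ (cong (when A₁) (F-extensions m (a ∸ 1) b (c ∸ 1)))
                   (cong₂ ℤ._-_ (cong (when A₁) (G1-∑ (suc m) (a ∸ 1) b (c ∸ 1)))
                                (cong (when A₂) (substY-G-∑ (suc m) (a ∸ 2) b (c ∸ 2)))) ⟨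
  when A₁ (F (suc (suc m)) (a ∸ 1) b (c ∸ 1))
    ℤ.+ (when A₁ (G1 (suc m) (a ∸ 1) b (c ∸ 1)) ℤ.- when A₂ (substY G (suc m) (a ∸ 2) b (c ∸ 2)))
    ≡⟨ cong (ℤ._+_ (when A₁ (F (suc (suc m)) (a ∸ 1) b (c ∸ 1)))) (ℤ.+-identityˡ _) ⟨
  recurrence-rhs 1 0 1 0 F G1 (substY G) (suc (suc m)) a b c ∎
  where
  open ≡.≡-Reasoning
  W : List (List ℕ)
  W = catWords (suc m)
  A₁ A₂ : Bool
  A₁ = (1 ≤ᵇ a) ∧ (1 ≤ᵇ c)
  A₂ = (2 ≤ᵇ a) ∧ (2 ≤ᵇ c)
  ext g₁ gy : List ℕ → ℤ
  ext w = extensions w (a ∸ 1) b (c ∸ 1)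
  g₁  w = G1-term w (a ∸ 1) b (c ∸ 1)
  gy  w = substY-G-term w (a ∸ 2) b (c ∸ 2)

F-recurrence : Recurrence 1 0 1 0 F G1 (substY G)
F-recurrence = recurrence unfold
  where
  unfold : F ≐ recurrence-rhs 1 0 1 0 F G1 (substY G)
  unfold zero          a b c = sym (trans (ℤ.+-identityʳ _) (when-zero ((1 ≤ᵇ a) ∧ (1 ≤ᵇ c))))
  unfold (suc zero)          = F-unfolds-length-1
  unfold (suc (suc m))       = F-unfolds-length-2+ m

lemma5p2 : (F ≐ Ay ⊕ By ⊛ substQ F) × (G ≐ Az ⊕ Bz ⊛ substQ G)
lemma5p2 = nested-closed-form F-recurrence S-recurrence , nested-closed-form G-recurrence S′-recurrence
  where
  G-recurrence : Recurrence 0 1 0 1 G F1 (substZ F)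
  G-recurrence = recurrence-swap F-recurrence
  S-recurrence : Recurrence 1 1 1 1 (substY G) F1 (substQ F)
  S-recurrence = recurrence-cong substY-F1 (substY∘substZ F) (recurrence-substY G-recurrence)
  S′-recurrence : Recurrence 1 1 1 1 (substZ F) G1 (substQ G)
  S′-recurrence = recurrence-cong (λ _ _ _ _ → refl) (swap-substQ F) (recurrence-swap S-recurrence)
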